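{- Let $A\in\mathbb{F}_2[x]$ be special and perfect. Then $$A=\mathrm{rad}(A)+\sum_{\substack{D\mid A,\ D\neq A,\ D\neq 1\\ D\text{ square-free}}}\sigma^{*\mathrm{inv}}(D)\cdot\frac{A}{D}.$$
   Context: $\sigma(A)$ is the sum of all divisors of $A$ in $\mathbb{F}_2[x]$; $A$ is perfect if $\sigma(A)=A$. $A$ is special if $A=S^2$ for some square-free $S\in\mathbb{F}_2[x]$ (a notion used for odd perfect polynomials, i.e. perfect polynomials with no irreducible factor of degree $1$). $\mathrm{rad}(A)$ is the product of the distinct irreducible factors of $A$. A divisor $D$ of $A$ is unitary if $\gcd(D,A/D)=1$, and $\sigma^*(A)$ is the sum of all unitary divisors of $A$. A function $f:\mathbb{F}_2[x]\setminus\{0\}\to\mathbb{F}_2[x]$ is multiplicative if $f(AB)=f(A)f(B)$ whenever $\gcd(A,B)=1$; the Dirichlet convolution is $(f*g)(A)=\sum_{D\mid A}f(D)g(A/D)$; $\delta(1)=1$, $\delta(A)=0$ for $A\ne1$; $\sigma^{*\mathrm{inv}}$ is the unique multiplicative function with $\sigma^**\sigma^{*\mathrm{inv}}=\delta$. Sums over $D\mid A$ run over all divisors of $A$ in $\mathbb{F}_2[x]$. -}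

module Defs where

open import Data.Bool using (Bool; true; false; not; _∧_; _∨_; _xor_; if_then_else_; T)
open import Data.Nat using (ℕ; zero; suc; _≤ᵇ_)
open import Data.List using (List; []; _∷_; map; foldr; filterᵇ; cartesianProduct; concatMap)
open import Data.Bool.ListAction using (all; any)
open import Data.Product using (_×_; _,_; Σ; ∃; proj₁; proj₂)
open import Data.Sum using (_⊎_)
open import Relation.Binary.PropositionalEquality using (_≡_)
open import Relation.Nullary using (¬_)

-- Polynomials over F₂, canonical representation (so _≡_ is equality
-- of polynomials).  A nonzero polynomial is either 1, or  b + x·q  with
-- q nonzero (coefficients listed from the constant term upwards).

data NZ : Set where
  one : NZ
  _◃_ : Bool → NZ → NZ

data Poly : Set where
  0p : Poly
  nz : NZ → Poly

1p : Poly
1p = nz one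

cons : Bool → Poly → Poly
cons false 0p     = 0p
cons true  0p     = nz one
cons b     (nz q) = nz (b ◃ q)

addNZ : NZ → NZ → Poly
addNZ one     one     = 0p
addNZ one     (b ◃ q) = nz (not b ◃ q)
addNZ (a ◃ p) one     = nz (not a ◃ p)
addNZ (a ◃ p) (b ◃ q) = cons (a xor b) (addNZ p q)

infixl 6 _+_
infixl 7 _*_

_+_ : Poly → Poly → Poly
0p   + q    = q
nz p + 0p   = nz p
nz p + nz q = addNZ p q

mulNZ : NZ → Poly → Poly
mulNZ one     q = q
mulNZ (b ◃ p) q = (if b then q else 0p) + cons false (mulNZ p q)

_*_ : Poly → Poly → Poly
0p   * q = 0p
nz p * q = mulNZ p q

-- degree (deg 0 := 0 by convention; only used for nonzero polynomials)
degNZ : NZ → ℕ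
degNZ one     = 0
degNZ (_ ◃ q) = suc (degNZ q)

deg : Poly → ℕ
deg 0p     = 0
deg (nz p) = degNZ p

eqB : Bool → Bool → Bool
eqB true  b = b
eqB false b = not b

eqNZ : NZ → NZ → Bool
eqNZ one     one     = true
eqNZ one     (_ ◃ _) = false
eqNZ (_ ◃ _) one     = false
eqNZ (a ◃ p) (b ◃ q) = eqB a b ∧ eqNZ p q

_==_ : Poly → Poly → Bool
0p   == 0p   = true
0p   == nz _ = false
nz _ == 0p   = false
nz p == nz q = eqNZ p q

_∣_ : Poly → Poly → Set
D ∣ A = ∃ λ E → D * E ≡ A

Irreducible : Poly → Set
Irreducible P = ¬ (P ≡ 0p) × ¬ (P ≡ 1p) × (∀ D → D ∣ P → D ≡ 1p ⊎ D ≡ P)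

SquareFree : Poly → Set
SquareFree S = ¬ (S ≡ 0p) × (∀ P → Irreducible P → ¬ ((P * P) ∣ S))

-- gcd(A,B) = 1  (over F₂ the only unit is 1)
Coprime : Poly → Poly → Set
Coprime A B = ∀ C → C ∣ A → C ∣ B → C ≡ 1p

Special : Poly → Set
Special A = ∃ λ S → SquareFree S × A ≡ S * S

nzUpTo : ℕ → List Poly
nzUpTo zero    = nz one ∷ []
nzUpTo (suc n) = nz one ∷ concatMap ext (nzUpTo n)
  where
  ext : Poly → List Poly
  ext 0p     = []
  ext (nz q) = nz (false ◃ q) ∷ nz (true ◃ q) ∷ []

-- all pairs (D , A/D) with D ∣ A  (for A ≠ 0; every divisor of a nonzero
-- A has degree ≤ deg A, and the quotient is unique)
divisorPairs : Poly → List (Poly × Poly)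
divisorPairs A =
  filterᵇ (λ p → (proj₁ p * proj₂ p) == A)
          (cartesianProduct (nzUpTo (deg A)) (nzUpTo (deg A)))

sumP : List Poly → Poly
sumP = foldr _+_ 0p

-- boolean decision procedures (bounded search, valid for nonzero arguments)
divides? : Poly → Poly → Bool
divides? D A = any (λ E → (D * E) == A) (nzUpTo (deg A))

irreducible? : Poly → Bool
irreducible? P =
  (1 ≤ᵇ deg P) ∧
  all (λ D → not (divides? D P) ∨ (D == 1p) ∨ (D == P)) (nzUpTo (deg P))

squarefree? : Poly → Bool
squarefree? S =
  not (S == 0p) ∧
  all (λ P → not (irreducible? P) ∨ not (divides? (P * P) S)) (nzUpTo (deg S))

coprime? : Poly → Poly → Bool
coprime? A B =
  all (λ C → not (divides? C A ∧ divides? C B) ∨ (C == 1p)) (nzUpTo (deg A))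

σ : Poly → Poly
σ A = sumP (map proj₁ (divisorPairs A))

Perfect : Poly → Set
Perfect A = σ A ≡ A

σ* : Poly → Poly
σ* A = sumP (map proj₁ (filterᵇ (λ p → coprime? (proj₁ p) (proj₂ p)) (divisorPairs A)))

rad : Poly → Poly
rad A = foldr _*_ 1p (filterᵇ (λ P → irreducible? P ∧ divides? P A) (nzUpTo (deg A)))

_⋆_ : (Poly → Poly) → (Poly → Poly) → Poly → Poly
(f ⋆ g) A = sumP (map (λ p → f (proj₁ p) * g (proj₂ p)) (divisorPairs A))

δ : Poly → Poly
δ A = if A == 1p then 1p else 0p

Multiplicative : (Poly → Poly) → Set
Multiplicative f =
  ∀ A B → ¬ (A ≡ 0p) → ¬ (B ≡ 0p) → Coprime A B → f (A * B) ≡ f A * f B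

corSum : (Poly → Poly) → Poly → Poly
corSum g A =
  sumP (map (λ p → g (proj₁ p) * proj₂ p)
            (filterᵇ (λ p → not (proj₁ p == A) ∧ not (proj₁ p == 1p) ∧ squarefree? (proj₁ p))
                     (divisorPairs A)))

-- Let g be the inverse of σ* and write A = S * S with S square-free.  The square-free divisors of S² are exactly the divisors of S, none of them
-- equal to A when S ≠ 1, so the sum is  Σ_{D ∣ S, D ≠ 1} g(D)·S·(S/D).  At an irreducible
-- P the only divisors are 1 and P, whence σ*(P) = 1 + P and, from σ* ⋆ g = δ, g(P) = 1 + P.
-- Splitting the divisors of P·T (P ∤ T) into those of T and P times those of T,
-- multiplicativity gives
--   Σ_{D ∣ P·T} g(D)·(P·T/D) = (P + (1 + P)) · Σ_{D ∣ T} g(D)·(T/D),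
-- so Σ_{D ∣ S} g(D)·(S/D) = 1 for square-free S.  Hence the sum is S·1 − S·S = S + A in
-- characteristic 2, and with rad A = S the right-hand side is S + S + A = A.
module Submission where

open import Defs
open import Relation.Binary.PropositionalEquality using (_≡_)
open import Relation.Nullary using (¬_)

open import Level using (Level)
open import Algebra.Bundles using (CommutativeRing)
open import Data.Bool using (Bool; true; false; not; _∧_; _∨_; _xor_; if_then_else_)
open import Data.Bool.ListAction using (all; any)
open import Data.Bool.Properties using (xor-comm; xor-assoc; xor-same; ∨-identityʳ; ∧-identityʳ)
open import Data.Empty using (⊥-elim)
open import Data.List using (List; []; _∷_; _++_; map; foldr; concatMap; filterᵇ; cartesianProduct)
open import Data.List.Properties using (map-++; map-∘; concatMap-cong)
open import Data.List.Membership.Propositional using (_∈_; find; lose)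
open import Data.List.Membership.Propositional.Properties using (∈-concatMap⁺; ∈-concatMap⁻)
open import Data.List.Relation.Unary.All as All using ([]; _∷_; tabulate)
open import Data.List.Relation.Unary.AllPairs using ([]; _∷_)
open import Data.List.Relation.Unary.Any using (here; there)
open import Data.List.Relation.Unary.Unique.Propositional using (Unique)
open import Data.List.Relation.Unary.Unique.Propositional.Properties using (++⁺; Unique[x∷xs]⇒x∉xs)
open import Data.Maybe using (just; nothing)
open import Data.Nat using (ℕ; zero; suc; _≤_; _<_; z≤n; s≤s; _≤ᵇ_) renaming (_+_ to _+ℕ_)
import Data.Nat.Properties as ℕ
open import Data.Product using (∃; ∃₂; _×_; _,_; proj₁; proj₂)
open import Data.Sum using (_⊎_; inj₁; inj₂; reduce)
open import Function using (id; _∘_)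
open import Relation.Binary.PropositionalEquality
  using (_≢_; refl; sym; trans; cong; cong₂; subst; isEquivalence; module ≡-Reasoning)
open import Relation.Nullary using (Dec; yes; no; _because_)
open import Relation.Nullary.Reflects
  using (Reflects; ofʸ; ofⁿ; det; _×-reflects_; _⊎-reflects_; _→-reflects_; ¬-reflects)
open import Tactic.RingSolver using (solve-∀)
open import Tactic.RingSolver.Core.AlmostCommutativeRing using (AlmostCommutativeRing; fromCommutativeRing)

open ≡-Reasoning

-- The commutative ring F₂[x]

infixr 7 _·_

_·_ : Bool → Poly → Poly
b · p = if b then p else 0p

-- X * p reduces to cons false p, so shifting is multiplication by X, which the ring
-- solver can see.
X : Poly
X = nz (false ◃ one)

data ConsView : Poly → Set where
  _∷ᵖ_ : ∀ b p → ConsView (cons b p)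

consView : ∀ p → ConsView p
consView 0p               = false ∷ᵖ 0p
consView (nz one)         = true ∷ᵖ 0p
consView (nz (false ◃ q)) = false ∷ᵖ nz q
consView (nz (true ◃ q))  = true ∷ᵖ nz q

Poly-ind : ∀ {ℓ} (Φ : Poly → Set ℓ) → Φ 0p → (∀ b p → Φ p → Φ (cons b p)) → ∀ p → Φ p
Poly-ind Φ z s 0p               = z
Poly-ind Φ z s (nz one)         = s true 0p z
Poly-ind Φ z s (nz (false ◃ q)) = s false (nz q) (Poly-ind Φ z s (nz q))
Poly-ind Φ z s (nz (true ◃ q))  = s true (nz q) (Poly-ind Φ z s (nz q))

+-identityʳ : ∀ p → p + 0p ≡ p
+-identityʳ 0p     = refl
+-identityʳ (nz _) = refl

+-comm : ∀ p q → p + q ≡ q + p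
+-comm 0p     0p     = refl
+-comm 0p     (nz _) = refl
+-comm (nz _) 0p     = refl
+-comm (nz p) (nz q) = addNZ-comm p q
  where
  addNZ-comm : ∀ p q → addNZ p q ≡ addNZ q p
  addNZ-comm one     one     = refl
  addNZ-comm one     (_ ◃ _) = refl
  addNZ-comm (_ ◃ _) one     = refl
  addNZ-comm (a ◃ p) (b ◃ q) = cong₂ cons (xor-comm a b) (addNZ-comm p q)

x+x≡0 : ∀ p → p + p ≡ 0p
x+x≡0 0p     = refl
x+x≡0 (nz p) = addNZ-self p
  where
  addNZ-self : ∀ p → addNZ p p ≡ 0p
  addNZ-self one     = refl
  addNZ-self (a ◃ p) rewrite xor-same a | addNZ-self p = refl

cons-+ : ∀ a p b q → cons a p + cons b q ≡ cons (a xor b) (p + q)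
cons-+ false 0p     false 0p     = refl
cons-+ false 0p     true  0p     = refl
cons-+ true  0p     false 0p     = refl
cons-+ true  0p     true  0p     = refl
cons-+ false 0p     false (nz q) = refl
cons-+ false 0p     true  (nz q) = refl
cons-+ true  0p     false (nz q) = refl
cons-+ true  0p     true  (nz q) = refl
cons-+ false (nz p) false 0p     = refl
cons-+ false (nz p) true  0p     = refl
cons-+ true  (nz p) false 0p     = refl
cons-+ true  (nz p) true  0p     = refl
cons-+ false (nz p) false (nz q) = refl
cons-+ false (nz p) true  (nz q) = refl
cons-+ true  (nz p) false (nz q) = refl
cons-+ true  (nz p) true  (nz q) = refl

+-assoc : ∀ p q r → (p + q) + r ≡ p + (q + r)
+-assoc = Poly-ind (λ p → ∀ q r → (p + q) + r ≡ p + (q + r)) (λ _ _ → refl) step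
  where
  step : ∀ a p → (∀ q r → (p + q) + r ≡ p + (q + r)) →
         ∀ q r → (cons a p + q) + r ≡ cons a p + (q + r)
  step a p ih q r with consView q | consView r
  ... | b ∷ᵖ q′ | c ∷ᵖ r′ = begin
    (cons a p + cons b q′) + cons c r′       ≡⟨ cong (_+ cons c r′) (cons-+ a p b q′) ⟩
    cons (a xor b) (p + q′) + cons c r′      ≡⟨ cons-+ (a xor b) (p + q′) c r′ ⟩
    cons ((a xor b) xor c) ((p + q′) + r′)   ≡⟨ cong₂ cons (xor-assoc a b c) (ih q′ r′) ⟩
    cons (a xor (b xor c)) (p + (q′ + r′))   ≡⟨ sym (cons-+ a p (b xor c) (q′ + r′)) ⟩
    cons a p + cons (b xor c) (q′ + r′)      ≡⟨ cong (cons a p +_) (sym (cons-+ b q′ c r′)) ⟩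
    cons a p + (cons b q′ + cons c r′)       ∎

+-interchange : ∀ a b c d → (a + b) + (c + d) ≡ (a + c) + (b + d)
+-interchange a b c d = begin
  (a + b) + (c + d)  ≡⟨ +-assoc a b (c + d) ⟩
  a + (b + (c + d))  ≡⟨ cong (a +_) (sym (+-assoc b c d)) ⟩
  a + ((b + c) + d)  ≡⟨ cong (λ u → a + (u + d)) (+-comm b c) ⟩
  a + ((c + b) + d)  ≡⟨ cong (a +_) (+-assoc c b d) ⟩
  a + (c + (b + d))  ≡⟨ sym (+-assoc a c (b + d)) ⟩
  (a + c) + (b + d)  ∎

X*-distrib-+ : ∀ p q → X * (p + q) ≡ X * p + X * q
X*-distrib-+ p q = sym (cons-+ false p false q)

cons-* : ∀ b p q → cons b p * q ≡ b · q + X * (p * q)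
cons-* false 0p     q = refl
cons-* true  0p     q = sym (+-identityʳ q)
cons-* false (nz p) q = refl
cons-* true  (nz p) q = refl

·-distrib-xor : ∀ a b q → (a xor b) · q ≡ a · q + b · q
·-distrib-xor false b     q = refl
·-distrib-xor true  false q = sym (+-identityʳ q)
·-distrib-xor true  true  q = sym (x+x≡0 q)

·-distrib-+ : ∀ a q r → a · (q + r) ≡ a · q + a · r
·-distrib-+ false q r = refl
·-distrib-+ true  q r = refl

*-distribʳ-+ : ∀ p q r → (p + q) * r ≡ p * r + q * r
*-distribʳ-+ = Poly-ind (λ p → ∀ q r → (p + q) * r ≡ p * r + q * r) (λ _ _ → refl) step
  where
  step : ∀ a p → (∀ q r → (p + q) * r ≡ p * r + q * r) →
         ∀ q r → (cons a p + q) * r ≡ cons a p * r + q * r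
  step a p ih q r with consView q
  ... | b ∷ᵖ q′ = begin
    (cons a p + cons b q′) * r
      ≡⟨ cong (_* r) (cons-+ a p b q′) ⟩
    cons (a xor b) (p + q′) * r
      ≡⟨ cons-* (a xor b) (p + q′) r ⟩
    (a xor b) · r + X * ((p + q′) * r)
      ≡⟨ cong₂ _+_ (·-distrib-xor a b r) (trans (cong (X *_) (ih q′ r)) (X*-distrib-+ (p * r) (q′ * r))) ⟩
    (a · r + b · r) + (X * (p * r) + X * (q′ * r))
      ≡⟨ +-interchange (a · r) (b · r) (X * (p * r)) (X * (q′ * r)) ⟩
    (a · r + X * (p * r)) + (b · r + X * (q′ * r))
      ≡⟨ sym (cong₂ _+_ (cons-* a p r) (cons-* b q′ r)) ⟩
    cons a p * r + cons b q′ * r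
      ∎

*-distribˡ-+ : ∀ p q r → p * (q + r) ≡ p * q + p * r
*-distribˡ-+ = Poly-ind (λ p → ∀ q r → p * (q + r) ≡ p * q + p * r) (λ _ _ → refl) step
  where
  step : ∀ a p → (∀ q r → p * (q + r) ≡ p * q + p * r) →
         ∀ q r → cons a p * (q + r) ≡ cons a p * q + cons a p * r
  step a p ih q r = begin
    cons a p * (q + r)
      ≡⟨ cons-* a p (q + r) ⟩
    a · (q + r) + X * (p * (q + r))
      ≡⟨ cong₂ _+_ (·-distrib-+ a q r) (trans (cong (X *_) (ih q r)) (X*-distrib-+ (p * q) (p * r))) ⟩
    (a · q + a · r) + (X * (p * q) + X * (p * r))
      ≡⟨ +-interchange (a · q) (a · r) (X * (p * q)) (X * (p * r)) ⟩
    (a · q + X * (p * q)) + (a · r + X * (p * r))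
      ≡⟨ sym (cong₂ _+_ (cons-* a p q) (cons-* a p r)) ⟩
    cons a p * q + cons a p * r
      ∎

*-zeroʳ : ∀ p → p * 0p ≡ 0p
*-zeroʳ = Poly-ind (λ p → p * 0p ≡ 0p) refl step
  where
  step : ∀ b p → p * 0p ≡ 0p → cons b p * 0p ≡ 0p
  step false p ih = trans (cons-* false p 0p) (cong (X *_) ih)
  step true  p ih = trans (cons-* true p 0p) (cong (X *_) ih)

cons≡·+X* : ∀ b p → cons b p ≡ b · 1p + X * p
cons≡·+X* false p = refl
cons≡·+X* true  p = sym (cons-+ true 0p false p)

*-identityʳ : ∀ p → p * 1p ≡ p
*-identityʳ = Poly-ind (λ p → p * 1p ≡ p) refl step
  where
  step : ∀ b p → p * 1p ≡ p → cons b p * 1p ≡ cons b p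
  step b p ih = begin
    cons b p * 1p           ≡⟨ cons-* b p 1p ⟩
    b · 1p + X * (p * 1p)   ≡⟨ cong (λ u → b · 1p + X * u) ih ⟩
    b · 1p + X * p          ≡⟨ sym (cons≡·+X* b p) ⟩
    cons b p                ∎

*-X*ʳ : ∀ p q → p * (X * q) ≡ X * (p * q)
*-X*ʳ = Poly-ind (λ p → ∀ q → p * (X * q) ≡ X * (p * q)) (λ _ → refl) step
  where
  ·-X* : ∀ a q → a · (X * q) ≡ X * (a · q)
  ·-X* false q = refl
  ·-X* true  q = refl
  step : ∀ a p → (∀ q → p * (X * q) ≡ X * (p * q)) →
         ∀ q → cons a p * (X * q) ≡ X * (cons a p * q)
  step a p ih q = begin
    cons a p * (X * q)                ≡⟨ cons-* a p (X * q) ⟩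
    a · (X * q) + X * (p * (X * q))   ≡⟨ cong₂ _+_ (·-X* a q) (cong (X *_) (ih q)) ⟩
    X * (a · q) + X * (X * (p * q))   ≡⟨ sym (X*-distrib-+ (a · q) (X * (p * q))) ⟩
    X * (a · q + X * (p * q))         ≡⟨ cong (X *_) (sym (cons-* a p q)) ⟩
    X * (cons a p * q)                ∎

*-cons : ∀ p b q → p * cons b q ≡ b · p + X * (p * q)
*-cons p b q = begin
  p * cons b q                ≡⟨ cong (p *_) (cons≡·+X* b q) ⟩
  p * (b · 1p + X * q)        ≡⟨ *-distribˡ-+ p (b · 1p) (X * q) ⟩
  p * (b · 1p) + p * (X * q)  ≡⟨ cong₂ _+_ (*-·1 p b) (*-X*ʳ p q) ⟩
  b · p + X * (p * q)         ∎
  where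
  *-·1 : ∀ p b → p * (b · 1p) ≡ b · p
  *-·1 p false = *-zeroʳ p
  *-·1 p true  = *-identityʳ p

*-comm : ∀ p q → p * q ≡ q * p
*-comm = Poly-ind (λ p → ∀ q → p * q ≡ q * p) (λ q → sym (*-zeroʳ q)) step
  where
  step : ∀ a p → (∀ q → p * q ≡ q * p) → ∀ q → cons a p * q ≡ q * cons a p
  step a p ih q = begin
    cons a p * q         ≡⟨ cons-* a p q ⟩
    a · q + X * (p * q)  ≡⟨ cong (λ u → a · q + X * u) (ih q) ⟩
    a · q + X * (q * p)  ≡⟨ sym (*-cons q a p) ⟩
    q * cons a p         ∎

·-*-assoc : ∀ a q r → (a · q) * r ≡ a · (q * r)
·-*-assoc false q r = refl
·-*-assoc true  q r = refl

*-assoc : ∀ p q r → (p * q) * r ≡ p * (q * r)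
*-assoc = Poly-ind (λ p → ∀ q r → (p * q) * r ≡ p * (q * r)) (λ _ _ → refl) step
  where
  step : ∀ a p → (∀ q r → (p * q) * r ≡ p * (q * r)) →
         ∀ q r → (cons a p * q) * r ≡ cons a p * (q * r)
  step a p ih q r = begin
    (cons a p * q) * r
      ≡⟨ cong (_* r) (cons-* a p q) ⟩
    (a · q + X * (p * q)) * r
      ≡⟨ *-distribʳ-+ (a · q) (X * (p * q)) r ⟩
    (a · q) * r + X * (p * q) * r
      ≡⟨ cong₂ _+_ (·-*-assoc a q r) (trans (cons-* false (p * q) r) (cong (X *_) (ih q r))) ⟩
    a · (q * r) + X * (p * (q * r))
      ≡⟨ sym (cons-* a p (q * r)) ⟩
    cons a p * (q * r)
      ∎

F₂[x] : CommutativeRing _ _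
F₂[x] = record
  { Carrier = Poly ; _≈_ = _≡_ ; _+_ = _+_ ; _*_ = _*_ ; -_ = id ; 0# = 0p ; 1# = 1p
  ; isCommutativeRing = record
    { isRing = record
      { +-isAbelianGroup = record
        { isGroup = record
          { isMonoid = record
            { isSemigroup = record
              { isMagma = record { isEquivalence = isEquivalence ; ∙-cong = cong₂ _+_ }
              ; assoc = +-assoc }
            ; identity = (λ _ → refl) , +-identityʳ }
          ; inverse = x+x≡0 , x+x≡0
          ; ⁻¹-cong = id }
        ; comm = +-comm }
      ; *-cong = cong₂ _*_
      ; *-assoc = *-assoc
      ; *-identity = (λ _ → refl) , *-identityʳ
      ; distrib = *-distribˡ-+ , λ x y z → *-distribʳ-+ y z x }
    ; *-comm = *-comm } }

F₂[x]-solver : AlmostCommutativeRing _ _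
F₂[x]-solver = fromCommutativeRing F₂[x] λ { 0p → just refl ; _ → nothing }

*-swap : ∀ a b c → a * (b * c) ≡ b * (a * c)
*-swap = solve-∀ F₂[x]-solver

-- Degree and long division

cons-nz : ∀ b q → cons b (nz q) ≡ nz (b ◃ q)
cons-nz false q = refl
cons-nz true  q = refl

nz≢0p : ∀ {p} → nz p ≢ 0p
nz≢0p ()

addNZ-lowerDeg : ∀ q s → degNZ q < degNZ s → ∃ λ t → addNZ q s ≡ nz t × degNZ t ≡ degNZ s
addNZ-lowerDeg one     (c ◃ s) _ = not c ◃ s , refl , refl
addNZ-lowerDeg (a ◃ q) (c ◃ s) (s≤s q<s) with addNZ-lowerDeg q s q<s
... | t , eq , d rewrite eq = (a xor c) ◃ t , cons-nz (a xor c) t , cong suc d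

addNZ-sameDeg : ∀ u v → degNZ u ≡ degNZ v →
                addNZ u v ≡ 0p ⊎ ∃ λ t → addNZ u v ≡ nz t × degNZ t < degNZ u
addNZ-sameDeg one     one     _ = inj₁ refl
addNZ-sameDeg (a ◃ u) (b ◃ v) e with addNZ-sameDeg u v (ℕ.suc-injective e)
... | inj₁ z rewrite z = lowest (a xor b)
  where
  lowest : ∀ c → cons c 0p ≡ 0p ⊎ ∃ λ t → cons c 0p ≡ nz t × degNZ t < suc (degNZ u)
  lowest false = inj₁ refl
  lowest true  = inj₂ (one , refl , s≤s z≤n)
... | inj₂ (t , e′ , lt) rewrite e′ = inj₂ ((a xor b) ◃ t , cons-nz (a xor b) t , s≤s lt)

mulNZ-nz : ∀ p q → ∃ λ r → mulNZ p (nz q) ≡ nz r × degNZ r ≡ degNZ p +ℕ degNZ q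
mulNZ-nz one q = q , refl , refl
mulNZ-nz (false ◃ p) q with mulNZ-nz p q
... | r , e , d rewrite e = false ◃ r , refl , cong suc d
mulNZ-nz (true ◃ p) q with mulNZ-nz p q
... | r , e , d rewrite e
  with addNZ-lowerDeg q (false ◃ r) (s≤s (subst (degNZ q ≤_) (sym d) (ℕ.m≤n+m _ _)))
... | t , e′ , d′ = t , e′ , trans d′ (cong suc d)

private
  *-nonZero : ∀ {A B} → A ≢ 0p → B ≢ 0p → A * B ≢ 0p × deg (A * B) ≡ deg A +ℕ deg B
  *-nonZero {0p}            A≢0 _   = ⊥-elim (A≢0 refl)
  *-nonZero {nz p} {0p}     _   B≢0 = ⊥-elim (B≢0 refl)
  *-nonZero {nz p} {nz q}   _   _ with mulNZ-nz p q
  ... | r , e , d rewrite e = nz≢0p , d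

*-≢0 : ∀ {A B} → A ≢ 0p → B ≢ 0p → A * B ≢ 0p
*-≢0 A≢0 B≢0 = proj₁ (*-nonZero A≢0 B≢0)

deg-* : ∀ {A B} → A ≢ 0p → B ≢ 0p → deg (A * B) ≡ deg A +ℕ deg B
deg-* A≢0 B≢0 = proj₂ (*-nonZero A≢0 B≢0)

deg≡0⇒≡1 : ∀ {P} → P ≢ 0p → deg P ≡ 0 → P ≡ 1p
deg≡0⇒≡1 {0p}          P≢0 _ = ⊥-elim (P≢0 refl)
deg≡0⇒≡1 {nz one}      _   _ = refl
deg≡0⇒≡1 {nz (_ ◃ _)}  _   ()

≢0∧≢1⇒deg≥1 : ∀ {P} → P ≢ 0p → P ≢ 1p → 1 ≤ deg P
≢0∧≢1⇒deg≥1 {0p}         P≢0 _   = ⊥-elim (P≢0 refl)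
≢0∧≢1⇒deg≥1 {nz one}     _   P≢1 = ⊥-elim (P≢1 refl)
≢0∧≢1⇒deg≥1 {nz (_ ◃ _)} _   _   = s≤s z≤n

x+y≡0⇒x≡y : ∀ {x y} → x + y ≡ 0p → x ≡ y
x+y≡0⇒x≡y {x} {y} e = begin
  x             ≡⟨ sym (+-identityʳ x) ⟩
  x + 0p        ≡⟨ cong (x +_) (sym (x+x≡0 y)) ⟩
  x + (y + y)   ≡⟨ sym (+-assoc x y y) ⟩
  (x + y) + y   ≡⟨ cong (_+ y) e ⟩
  y             ∎

*-cancelˡ : ∀ {D E E′} → D ≢ 0p → D * E ≡ D * E′ → E ≡ E′
*-cancelˡ {D} {E} {E′} D≢0 e with E + E′ in eq
... | 0p   = x+y≡0⇒x≡y eq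
... | nz w = ⊥-elim (*-≢0 D≢0 nz≢0p (begin
  D * nz w            ≡⟨ cong (D *_) (sym eq) ⟩
  D * (E + E′)        ≡⟨ *-distribˡ-+ D E E′ ⟩
  D * E + D * E′      ≡⟨ cong (_+ D * E′) e ⟩
  D * E′ + D * E′     ≡⟨ x+x≡0 (D * E′) ⟩
  0p                  ∎))

-- deg 0p is 0 in Defs, so "degree below d" has to allow the zero polynomial separately.
infix 4 _<ᵈ_

_<ᵈ_ : Poly → ℕ → Set
r <ᵈ d = r ≡ 0p ⊎ deg r < d

-- rem and quo read the coefficients from the leading one downwards, subtracting β
-- whenever the running remainder reaches degree deg β.
module LongDivision (β : NZ) where

  private
    B = nz β

  reducible : Poly → Bool
  reducible 0p     = false
  reducible (nz t) = degNZ β ≤ᵇ degNZ t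

  reduceOnce : Poly → Poly
  reduceOnce r = r + reducible r · B

  rem : Poly → Poly
  rem 0p           = 0p
  rem (nz one)     = reduceOnce (cons true 0p)
  rem (nz (b ◃ q)) = reduceOnce (cons b (rem (nz q)))

  quo : Poly → Poly
  quo 0p           = 0p
  quo (nz one)     = cons (reducible (cons true 0p)) 0p
  quo (nz (b ◃ q)) = cons (reducible (cons b (rem (nz q)))) (quo (nz q))

  rem-cons : ∀ b p → rem (cons b p) ≡ reduceOnce (cons b (rem p))
  rem-cons false 0p     = refl
  rem-cons true  0p     = refl
  rem-cons false (nz _) = refl
  rem-cons true  (nz _) = refl

  quo-cons : ∀ b p → quo (cons b p) ≡ cons (reducible (cons b (rem p))) (quo p)
  quo-cons false 0p     = refl
  quo-cons true  0p     = refl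
  quo-cons false (nz _) = refl
  quo-cons true  (nz _) = refl

  cons-<ᵈ : ∀ b r → r <ᵈ degNZ β → cons b r <ᵈ suc (degNZ β)
  cons-<ᵈ false 0p     _          = inj₁ refl
  cons-<ᵈ true  0p     _          = inj₂ (s≤s z≤n)
  cons-<ᵈ _     (nz _) (inj₁ ())
  cons-<ᵈ false (nz _) (inj₂ lt)  = inj₂ (s≤s lt)
  cons-<ᵈ true  (nz _) (inj₂ lt)  = inj₂ (s≤s lt)

  reduceOnce-<ᵈ : ∀ r → r <ᵈ suc (degNZ β) → reduceOnce r <ᵈ degNZ β
  reduceOnce-<ᵈ 0p     _                  = inj₁ refl
  reduceOnce-<ᵈ (nz t) (inj₁ ())
  reduceOnce-<ᵈ (nz t) (inj₂ (s≤s t≤β))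
    with degNZ β ≤ᵇ degNZ t | ℕ.≤ᵇ-reflects-≤ (degNZ β) (degNZ t)
  ... | false | ofⁿ β≰t = inj₂ (ℕ.≤∧≢⇒< t≤β λ t≡β → β≰t (ℕ.≤-reflexive (sym t≡β)))
  ... | true  | ofʸ β≤t with addNZ-sameDeg t β (ℕ.≤-antisym t≤β β≤t)
  ...   | inj₁ t+β≡0            = inj₁ t+β≡0
  ...   | inj₂ (u , t+β≡u , u<t) rewrite t+β≡u = inj₂ (subst (degNZ u <_) (ℕ.≤-antisym t≤β β≤t) u<t)

  rem-<ᵈ : ∀ A → rem A <ᵈ degNZ β
  rem-<ᵈ = Poly-ind (λ A → rem A <ᵈ degNZ β) (inj₁ refl)
    (λ b p ih → subst (_<ᵈ degNZ β) (sym (rem-cons b p)) (reduceOnce-<ᵈ _ (cons-<ᵈ b (rem p) ih)))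

  quo-rem : ∀ A → A ≡ quo A * B + rem A
  quo-rem = Poly-ind (λ A → A ≡ quo A * B + rem A) refl step-quo-rem
    where
    step-quo-rem : ∀ b p → p ≡ quo p * B + rem p → cons b p ≡ quo (cons b p) * B + rem (cons b p)
    step-quo-rem b p ih rewrite quo-cons b p | rem-cons b p = begin
      cons b p
        ≡⟨ cons≡·+X* b p ⟩
      b · 1p + X * p
        ≡⟨ cong (λ z → b · 1p + X * z) ih ⟩
      b · 1p + X * (Q * B + R)
        ≡⟨ rearrange (b · 1p) (c · 1p) Q R B ⟩
      (c · 1p + X * Q) * B + (b · 1p + X * R + (c · 1p) * B)
        ≡⟨ sym (cong₂ (λ u v → u * B + (v + (c · 1p) * B)) (cons≡·+X* c Q) (cons≡·+X* b R)) ⟩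
      cons c Q * B + (cons b R + (c · 1p) * B)
        ≡⟨ cong (λ w → cons c Q * B + (cons b R + w)) (·-*-assoc c 1p B) ⟩
      cons c Q * B + (cons b R + c · B)
        ∎
      where
      Q = quo p
      R = rem p
      c = reducible (cons b R)
      rearrange : ∀ b c Q R B → b + X * (Q * B + R) ≡ (c + X * Q) * B + (b + X * R + c * B)
      rearrange = solve-∀ F₂[x]-solver

infixl 7 _/_ _%_

_/_ : Poly → Poly → Poly
A / 0p   = 0p
A / nz β = LongDivision.quo β A

_%_ : Poly → Poly → Poly
A % 0p   = A
A % nz β = LongDivision.rem β A

A≡A/D*D+A%D : ∀ A D → D ≢ 0p → A ≡ A / D * D + A % D
A≡A/D*D+A%D A 0p     D≢0 = ⊥-elim (D≢0 refl)
A≡A/D*D+A%D A (nz β) _   = LongDivision.quo-rem β A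

A%D<ᵈdegD : ∀ A D → D ≢ 0p → A % D <ᵈ deg D
A%D<ᵈdegD A 0p     D≢0 = ⊥-elim (D≢0 refl)
A%D<ᵈdegD A (nz β) _   = LongDivision.rem-<ᵈ β A

/-unique : ∀ {D E A} → D ≢ 0p → D * E ≡ A → A / D ≡ E
/-unique {D} {E} {A} D≢0 DE≡A with E + A / D in eq
... | 0p   = sym (x+y≡0⇒x≡y eq)
... | nz w = ⊥-elim (remainder-too-big (A%D<ᵈdegD A D D≢0))
  where
  remainder≡ : A % D ≡ D * nz w
  remainder≡ = begin
    A % D                          ≡⟨ remainder-of (A / D) D (A % D) ⟩
    A / D * D + A % D + A / D * D  ≡⟨ cong (_+ A / D * D) (sym (A≡A/D*D+A%D A D D≢0)) ⟩
    A + A / D * D                  ≡⟨ cong (_+ A / D * D) (sym DE≡A) ⟩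
    D * E + A / D * D              ≡⟨ factor D E (A / D) ⟩
    D * (E + A / D)                ≡⟨ cong (D *_) eq ⟩
    D * nz w                       ∎
    where
    remainder-of : ∀ Q D R → R ≡ Q * D + R + Q * D
    remainder-of = solve-∀ F₂[x]-solver
    factor : ∀ D E Q → D * E + Q * D ≡ D * (E + Q)
    factor = solve-∀ F₂[x]-solver
  remainder-too-big : ¬ (A % D <ᵈ deg D)
  remainder-too-big (inj₁ R≡0) = *-≢0 D≢0 nz≢0p (trans (sym remainder≡) R≡0)
  remainder-too-big (inj₂ R<D) = ℕ.<-irrefl refl (ℕ.≤-<-trans deg-D≤deg-R R<D)
    where
    deg-D≤deg-R : deg D ≤ deg (A % D)
    deg-D≤deg-R = subst (deg D ≤_) (sym (trans (cong deg remainder≡) (deg-* D≢0 nz≢0p))) (ℕ.m≤m+n _ _)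

-- Divisibility, Bézout and Euclid

∣-refl : ∀ {A} → A ∣ A
∣-refl {A} = 1p , *-identityʳ A

1∣_ : ∀ A → 1p ∣ A
1∣ A = A , refl

∣-trans : ∀ {A B C} → A ∣ B → B ∣ C → A ∣ C
∣-trans {A} (E , refl) (F , refl) = E * F , sym (*-assoc A E F)

∣m∣n⇒∣m+n : ∀ {D M N} → D ∣ M → D ∣ N → D ∣ (M + N)
∣m∣n⇒∣m+n {D} (E , refl) (F , refl) = E + F , *-distribˡ-+ D E F

m∣m*n : ∀ M N → M ∣ (M * N)
m∣m*n M N = N , refl

n∣m*n : ∀ M N → N ∣ (M * N)
n∣m*n M N = M , *-comm N M

∣n⇒∣m*n : ∀ M {D N} → D ∣ N → D ∣ (M * N)
∣n⇒∣m*n M {D} (E , refl) = M * E , *-swap D M E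

*-monoʳ-∣ : ∀ O {M N} → M ∣ N → (O * M) ∣ (O * N)
*-monoʳ-∣ O {M} (E , refl) = E , *-assoc O M E

∣-≢0 : ∀ {D A} → A ≢ 0p → D ∣ A → D ≢ 0p
∣-≢0 A≢0 (E , refl) refl = A≢0 refl

quotient-≢0 : ∀ {D E A} → A ≢ 0p → D * E ≡ A → E ≢ 0p
quotient-≢0 {D} A≢0 DE≡A refl = A≢0 (trans (sym DE≡A) (*-zeroʳ D))

∣⇒deg≤ : ∀ {D A} → A ≢ 0p → D ∣ A → deg D ≤ deg A
∣⇒deg≤ {D} {A} A≢0 (E , DE≡A) =
  subst (deg D ≤_) deg[DE]≡degA (ℕ.m≤m+n (deg D) (deg E))
  where
  deg[DE]≡degA : deg D +ℕ deg E ≡ deg A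
  deg[DE]≡degA = trans (sym (deg-* (∣-≢0 {D} A≢0 (E , DE≡A)) (quotient-≢0 {D} A≢0 DE≡A))) (cong deg DE≡A)

∣∧≢⇒deg< : ∀ {D A} → A ≢ 0p → D ∣ A → D ≢ A → deg D < deg A
∣∧≢⇒deg< {D} {A} A≢0 (E , DE≡A) D≢A = ℕ.≤∧≢⇒< (∣⇒deg≤ {D} A≢0 (E , DE≡A)) same-deg⇒≡
  where
  D≢0 = ∣-≢0 {D} A≢0 (E , DE≡A)
  E≢0 = quotient-≢0 {D} A≢0 DE≡A
  same-deg⇒≡ : deg D ≢ deg A
  same-deg⇒≡ degD≡degA with deg≡0⇒≡1 E≢0 (ℕ.+-cancelˡ-≡ (deg D) (deg E) 0 (begin
    deg D +ℕ deg E  ≡⟨ sym (deg-* D≢0 E≢0) ⟩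
    deg (D * E)     ≡⟨ cong deg DE≡A ⟩
    deg A           ≡⟨ sym degD≡degA ⟩
    deg D           ≡⟨ sym (ℕ.+-identityʳ (deg D)) ⟩
    deg D +ℕ 0      ∎))
  ... | refl = D≢A (trans (sym (*-identityʳ D)) DE≡A)

∣1⇒≡1 : ∀ {D} → D ∣ 1p → D ≡ 1p
∣1⇒≡1 {D} D∣1 = deg≡0⇒≡1 (∣-≢0 {D} (λ ()) D∣1) (ℕ.n≤0⇒n≡0 (∣⇒deg≤ {D} (λ ()) D∣1))

D*[A/D]≡A : ∀ {D A} → D ≢ 0p → D ∣ A → D * (A / D) ≡ A
D*[A/D]≡A {D} D≢0 (E , DE≡A) = trans (cong (D *_) (/-unique D≢0 DE≡A)) DE≡A

A/1≡A : ∀ A → A / 1p ≡ A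
A/1≡A A = /-unique {1p} (λ ()) refl

A/A≡1 : ∀ {A} → A ≢ 0p → A / A ≡ 1p
A/A≡1 {A} A≢0 = /-unique A≢0 (*-identityʳ A)

[C*T]/D≡C*[T/D] : ∀ C {D T} → D ≢ 0p → D ∣ T → (C * T) / D ≡ C * (T / D)
[C*T]/D≡C*[T/D] C {D} {T} D≢0 D∣T = /-unique D≢0 (begin
  D * (C * (T / D))  ≡⟨ *-swap D C (T / D) ⟩
  C * (D * (T / D))  ≡⟨ cong (C *_) (D*[A/D]≡A D≢0 D∣T) ⟩
  C * T              ∎)

[C*T]/[C*D]≡T/D : ∀ {C D T} → C ≢ 0p → D ≢ 0p → D ∣ T → (C * T) / (C * D) ≡ T / D
[C*T]/[C*D]≡T/D {C} {D} {T} C≢0 D≢0 D∣T = /-unique (*-≢0 C≢0 D≢0) (begin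
  C * D * (T / D)    ≡⟨ *-assoc C D (T / D) ⟩
  C * (D * (T / D))  ≡⟨ cong (C *_) (D*[A/D]≡A D≢0 D∣T) ⟩
  C * T              ∎)

a*[C*T/D]≡C*[a*[T/D]] : ∀ a C {D T} → D ≢ 0p → D ∣ T → a * (C * T / D) ≡ C * (a * (T / D))
a*[C*T/D]≡C*[a*[T/D]] a C D≢0 D∣T = trans (cong (a *_) ([C*T]/D≡C*[T/D] C D≢0 D∣T)) (*-swap a C _)

Bezout : Poly → Poly → Set
Bezout X Y = ∃ λ G → G ∣ X × G ∣ Y × ∃₂ λ u v → G ≡ u * X + v * Y

bezout-<ᵈ : ∀ n X Y → Y <ᵈ n → Bezout X Y
bezout-<ᵈ n X 0p _ = X , ∣-refl , (0p , *-zeroʳ X) , 1p , 0p , sym (+-identityʳ X)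
bezout-<ᵈ zero X (nz β) (inj₁ ())
bezout-<ᵈ zero X (nz β) (inj₂ ())
bezout-<ᵈ (suc n) X Y@(nz β) Y<n
  with bezout-<ᵈ n Y (X % Y) (remainder-<ᵈ (A%D<ᵈdegD X Y nz≢0p) Y<n)
  where
  remainder-<ᵈ : X % Y <ᵈ deg Y → Y <ᵈ suc n → X % Y <ᵈ n
  remainder-<ᵈ (inj₁ R≡0)  _                  = inj₁ R≡0
  remainder-<ᵈ (inj₂ R<Y)  (inj₁ ())
  remainder-<ᵈ (inj₂ R<Y)  (inj₂ (s≤s Y≤n))   = inj₂ (ℕ.<-≤-trans R<Y Y≤n)
... | G , G∣Y , G∣R , u , v , G≡ = G , G∣X , G∣Y , v , u + v * Q , G≡′
  where
  Q = X / Y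
  R = X % Y
  X≡ : X ≡ Q * Y + R
  X≡ = A≡A/D*D+A%D X Y nz≢0p
  G∣X : G ∣ X
  G∣X = subst (G ∣_) (sym X≡) (∣m∣n⇒∣m+n {G} (∣n⇒∣m*n Q {G} G∣Y) G∣R)
  regroup : ∀ u v Y R Q → u * Y + v * R ≡ v * (Q * Y + R) + (u + v * Q) * Y
  regroup = solve-∀ F₂[x]-solver
  G≡′ : G ≡ v * X + (u + v * Q) * Y
  G≡′ = trans G≡ (trans (regroup u v Y R Q) (cong (λ Z → v * Z + (u + v * Q) * Y) (sym X≡)))

bezout : ∀ X Y → Bezout X Y
bezout X Y = bezout-<ᵈ (suc (deg Y)) X Y (inj₂ ℕ.≤-refl)

irreducible-bezout : ∀ {P} → Irreducible P → ∀ X → P ∣ X ⊎ ∃₂ λ u v → 1p ≡ u * P + v * X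
irreducible-bezout (_ , _ , divisors) X with bezout _ X
... | G , G∣P , G∣X , u , v , G≡ with divisors G G∣P
...   | inj₁ refl = inj₂ (u , v , G≡)
...   | inj₂ refl = inj₁ G∣X

bezout-∣-cancelˡ : ∀ {P D T u v} → 1p ≡ u * P + v * D → D ∣ (P * T) → D ∣ T
bezout-∣-cancelˡ {P} {D} {T} {u} {v} 1≡ D∣PT =
  subst (D ∣_) (sym T≡) (∣m∣n⇒∣m+n {D} (∣n⇒∣m*n u {D} D∣PT) (∣n⇒∣m*n (v * T) {D} ∣-refl))
  where
  expand : ∀ u P v D T → (u * P + v * D) * T ≡ u * (P * T) + (v * T) * D
  expand = solve-∀ F₂[x]-solver
  T≡ : T ≡ u * (P * T) + (v * T) * D
  T≡ = trans (cong (_* T) 1≡) (expand u P v D T)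

irreducible-∣-cancelˡ : ∀ {P D T} → Irreducible P → ¬ P ∣ D → D ∣ (P * T) → D ∣ T
irreducible-∣-cancelˡ {P} {D} P-irr P∤D D∣PT with irreducible-bezout P-irr D
... | inj₁ P∣D           = ⊥-elim (P∤D P∣D)
... | inj₂ (u , v , 1≡)  = bezout-∣-cancelˡ {u = u} {v} 1≡ D∣PT

euclid : ∀ {P X Y} → Irreducible P → P ∣ (X * Y) → P ∣ X ⊎ P ∣ Y
euclid {P} {X} {Y} P-irr P∣XY with irreducible-bezout P-irr X
... | inj₁ P∣X          = inj₁ P∣X
... | inj₂ (u , v , 1≡) = inj₂ (bezout-∣-cancelˡ {u = v} {u} (trans 1≡ (+-comm (u * P) (v * X))) P∣XY)

irreducible-∣-irreducible : ∀ {Q P} → Irreducible Q → Irreducible P → Q ∣ P → Q ≡ P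
irreducible-∣-irreducible (_ , Q≢1 , _) (_ , _ , divisors) Q∣P with divisors _ Q∣P
... | inj₁ Q≡1 = ⊥-elim (Q≢1 Q≡1)
... | inj₂ Q≡P = Q≡P

irreducible-coprime : ∀ {P X} → Irreducible P → ¬ P ∣ X → Coprime P X
irreducible-coprime (_ , _ , divisors) P∤X C C∣P C∣X with divisors C C∣P
... | inj₁ C≡1 = C≡1
... | inj₂ refl = ⊥-elim (P∤X C∣X)

-- Enumeration of nonzero polynomials, and decision procedures

-- A copy of the auxiliary function in the definition of nzUpTo, which is not accessible.
extend : Poly → List Poly
extend 0p     = []
extend (nz q) = nz (false ◃ q) ∷ nz (true ◃ q) ∷ []

nzUpTo-suc : ∀ n → nzUpTo (suc n) ≡ nz one ∷ concatMap extend (nzUpTo n)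
nzUpTo-suc n = cong (nz one ∷_) (concatMap-cong (λ { 0p → refl ; (nz q) → refl }) (nzUpTo n))

dropConst : Poly → Poly
dropConst (nz (_ ◃ q)) = nz q
dropConst _            = 0p

∈-extend⇒dropConst : ∀ {y x} → y ∈ extend x → dropConst y ≡ x
∈-extend⇒dropConst {x = nz q} (here refl)         = refl
∈-extend⇒dropConst {x = nz q} (there (here refl)) = refl

∈-concatMap-extend⁻ : ∀ {y} L → y ∈ concatMap extend L → ∃ λ x → x ∈ L × y ∈ extend x
∈-concatMap-extend⁻ L = find ∘ ∈-concatMap⁻ extend {L}

unique-concatMap-extend : ∀ {L} → Unique L → Unique (concatMap extend L)
unique-concatMap-extend {[]}    _         = []
unique-concatMap-extend {x ∷ L} u@(_ ∷ uL) =
  ++⁺ (unique-extend x) (unique-concatMap-extend uL) disjoint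
  where
  unique-extend : ∀ x → Unique (extend x)
  unique-extend 0p     = []
  unique-extend (nz q) = ((λ ()) ∷ []) ∷ [] ∷ []
  disjoint : ∀ {y} → ¬ (y ∈ extend x × y ∈ concatMap extend L)
  disjoint (y∈x , y∈L) with ∈-concatMap-extend⁻ L y∈L
  ... | x′ , x′∈L , y∈x′ =
    Unique[x∷xs]⇒x∉xs u (subst (_∈ L) (trans (sym (∈-extend⇒dropConst y∈x′)) (∈-extend⇒dropConst y∈x))
                                  x′∈L)

∈-extend : ∀ b q → nz (b ◃ q) ∈ extend (nz q)
∈-extend false q = here refl
∈-extend true  q = there (here refl)

nzUpTo-unique : ∀ n → Unique (nzUpTo n)
nzUpTo-unique zero    = [] ∷ []
nzUpTo-unique (suc n) rewrite nzUpTo-suc n =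
  tabulate one∉ ∷ unique-concatMap-extend (nzUpTo-unique n)
  where
  one∉ : ∀ {y} → y ∈ concatMap extend (nzUpTo n) → nz one ≢ y
  one∉ y∈ refl with ∈-concatMap-extend⁻ (nzUpTo n) y∈
  ... | nz q , _ , here ()
  ... | nz q , _ , there (here ())

∈-nzUpTo⁻ : ∀ n {y} → y ∈ nzUpTo n → y ≢ 0p × deg y ≤ n
∈-nzUpTo⁻ zero    (here refl) = nz≢0p , z≤n
∈-nzUpTo⁻ (suc n) {y} y∈ with subst (y ∈_) (nzUpTo-suc n) y∈
... | here refl = nz≢0p , z≤n
... | there y∈′ with ∈-concatMap-extend⁻ (nzUpTo n) y∈′
...   | nz q , q∈ , here refl         = nz≢0p , s≤s (proj₂ (∈-nzUpTo⁻ n q∈))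
...   | nz q , q∈ , there (here refl) = nz≢0p , s≤s (proj₂ (∈-nzUpTo⁻ n q∈))

∈-nzUpTo⁺ : ∀ n {y} → y ≢ 0p → deg y ≤ n → y ∈ nzUpTo n
∈-nzUpTo⁺ n       {0p}         y≢0 _         = ⊥-elim (y≢0 refl)
∈-nzUpTo⁺ zero    {nz one}     _   _         = here refl
∈-nzUpTo⁺ (suc n) {nz one}     _   _         = here refl
∈-nzUpTo⁺ (suc n) {nz (b ◃ q)} _   (s≤s q≤n) = subst (nz (b ◃ q) ∈_) (sym (nzUpTo-suc n))
  (there (∈-concatMap⁺ extend (lose (∈-nzUpTo⁺ n nz≢0p q≤n) (∈-extend b q))))

∣⇒∈nzUpTo : ∀ {D A} → A ≢ 0p → D ∣ A → D ∈ nzUpTo (deg A)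
∣⇒∈nzUpTo {D} A≢0 D∣A = ∈-nzUpTo⁺ _ (∣-≢0 {D} A≢0 D∣A) (∣⇒deg≤ {D} A≢0 D∣A)

reflects-map : ∀ {P Q : Set} {b} → (P → Q) → (Q → P) → Reflects P b → Reflects Q b
reflects-map f g (ofʸ p)  = ofʸ (f p)
reflects-map f g (ofⁿ ¬p) = ofⁿ (¬p ∘ g)

==-reflects : ∀ p q → Reflects (p ≡ q) (p == q)
==-reflects 0p     0p     = ofʸ refl
==-reflects 0p     (nz _) = ofⁿ λ ()
==-reflects (nz _) 0p     = ofⁿ λ ()
==-reflects (nz p) (nz q) = reflects-map (cong nz) (λ { refl → refl }) (eqNZ-reflects p q)
  where
  eqNZ-reflects : ∀ p q → Reflects (p ≡ q) (eqNZ p q)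
  eqNZ-reflects one         one         = ofʸ refl
  eqNZ-reflects one         (_ ◃ _)     = ofⁿ λ ()
  eqNZ-reflects (_ ◃ _)     one         = ofⁿ λ ()
  eqNZ-reflects (true ◃ p)  (true ◃ q)  = reflects-map (cong (true ◃_)) (λ { refl → refl }) (eqNZ-reflects p q)
  eqNZ-reflects (false ◃ p) (false ◃ q) = reflects-map (cong (false ◃_)) (λ { refl → refl }) (eqNZ-reflects p q)
  eqNZ-reflects (true ◃ p)  (false ◃ q) = ofⁿ λ ()
  eqNZ-reflects (false ◃ p) (true ◃ q)  = ofⁿ λ ()

module _ {A : Set} {Q : A → Set} (q : A → Bool) where

  any-reflects : ∀ xs → (∀ {x} → x ∈ xs → Reflects (Q x) (q x)) →
                 Reflects (∃ λ x → x ∈ xs × Q x) (any q xs)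
  any-reflects []       _ = ofⁿ λ ()
  any-reflects (x ∷ xs) r with q x | r (here refl)
  ... | true  | ofʸ Qx = ofʸ (x , here refl , Qx)
  ... | false | ofⁿ ¬Qx = reflects-map later now-or-later (any-reflects xs (r ∘ there))
    where
    later : (∃ λ y → y ∈ xs × Q y) → ∃ λ y → y ∈ x ∷ xs × Q y
    later (y , y∈ , Qy) = y , there y∈ , Qy
    now-or-later : (∃ λ y → y ∈ x ∷ xs × Q y) → ∃ λ y → y ∈ xs × Q y
    now-or-later (y , here refl , Qy) = ⊥-elim (¬Qx Qy)
    now-or-later (y , there y∈ , Qy)  = y , y∈ , Qy

  all-reflects : ∀ xs → (∀ {x} → x ∈ xs → Reflects (Q x) (q x)) →
                 Reflects (∀ {x} → x ∈ xs → Q x) (all q xs)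
  all-reflects []       _ = ofʸ λ ()
  all-reflects (x ∷ xs) r with q x | r (here refl)
  ... | false | ofⁿ ¬Qx = ofⁿ λ h → ¬Qx (h (here refl))
  ... | true  | ofʸ Qx = reflects-map now-and-later (λ h → h ∘ there) (all-reflects xs (r ∘ there))
    where
    now-and-later : (∀ {y} → y ∈ xs → Q y) → ∀ {y} → y ∈ x ∷ xs → Q y
    now-and-later h (here refl) = Qx
    now-and-later h (there y∈)  = h y∈

divides?-reflects : ∀ {A} → A ≢ 0p → ∀ D → Reflects (D ∣ A) (divides? D A)
divides?-reflects {A} A≢0 D =
  reflects-map (λ (E , _ , DE≡A) → E , DE≡A)
               (λ (E , DE≡A) → E , ∣⇒∈nzUpTo A≢0 (D , trans (*-comm E D) DE≡A) , DE≡A)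
               (any-reflects (λ E → (D * E) == A) (nzUpTo (deg A)) (λ {E} _ → ==-reflects (D * E) A))

irreducible?-reflects : ∀ P → Reflects (Irreducible P) (irreducible? P)
irreducible?-reflects 0p             = ofⁿ λ irr → proj₁ irr refl
irreducible?-reflects (nz one)       = ofⁿ λ irr → proj₁ (proj₂ irr) refl
irreducible?-reflects P@(nz (_ ◃ _)) =
  reflects-map (λ h → nz≢0p , (λ ()) , λ D D∣P → h (∣⇒∈nzUpTo {D} nz≢0p D∣P) D∣P)
               (λ irr {D} _ D∣P → proj₂ (proj₂ irr) D D∣P)
               (all-reflects _ (nzUpTo (deg P)) λ {D} _ →
                  divides?-reflects nz≢0p D →-reflects (==-reflects D 1p ⊎-reflects ==-reflects D P))

squarefree?-reflects : ∀ S → Reflects (SquareFree S) (squarefree? S)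
squarefree?-reflects 0p       = ofⁿ λ sqf → proj₁ sqf refl
squarefree?-reflects S@(nz _) =
  reflects-map (λ h → nz≢0p , λ P irr PP∣S →
                  h (∣⇒∈nzUpTo {P} nz≢0p (∣-trans {P} (m∣m*n P P) PP∣S)) irr PP∣S)
               (λ sqf {P} _ → proj₂ sqf P)
               (all-reflects _ (nzUpTo (deg S)) λ {P} _ →
                  irreducible?-reflects P →-reflects ¬-reflects (divides?-reflects nz≢0p (P * P)))

coprime?-reflects : ∀ {A B} → A ≢ 0p → B ≢ 0p → Reflects (Coprime A B) (coprime? A B)
coprime?-reflects {A} {B} A≢0 B≢0 =
  reflects-map (λ h C C∣A C∣B → h (∣⇒∈nzUpTo {C} A≢0 C∣A) (C∣A , C∣B))
               (λ cop {C} _ (C∣A , C∣B) → cop C C∣A C∣B)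
               (all-reflects _ (nzUpTo (deg A)) λ {C} _ →
                  (divides?-reflects A≢0 C ×-reflects divides?-reflects B≢0 C) →-reflects ==-reflects C 1p)

==-true : ∀ {p q} → p ≡ q → (p == q) ≡ true
==-true {p} {q} p≡q = det (==-reflects p q) (ofʸ p≡q)

==-false : ∀ {p q} → p ≢ q → (p == q) ≡ false
==-false {p} {q} p≢q = det (==-reflects p q) (ofⁿ p≢q)

infix 4 _≟_

_≟_ : ∀ (p q : Poly) → Dec (p ≡ q)
p ≟ q = (p == q) because ==-reflects p q

-- Finite sums

∑ : ∀ {A : Set} → List A → (A → Poly) → Poly
∑ L f = sumP (map f L)

syntax ∑ L (λ x → e) = ∑[ x ← L ] e

module _ {A : Set} where

  ∑-cong : ∀ (L : List A) {f g : A → Poly} → (∀ {x} → x ∈ L → f x ≡ g x) → ∑ L f ≡ ∑ L g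
  ∑-cong []      _  = refl
  ∑-cong (x ∷ L) eq = cong₂ _+_ (eq (here refl)) (∑-cong L (eq ∘ there))

  ∑-zero : ∀ (L : List A) → ∑[ x ← L ] 0p ≡ 0p
  ∑-zero []      = refl
  ∑-zero (_ ∷ L) = ∑-zero L

  ∑-distrib-+ : ∀ (L : List A) (f g : A → Poly) → ∑[ x ← L ] (f x + g x) ≡ ∑ L f + ∑ L g
  ∑-distrib-+ []      f g = refl
  ∑-distrib-+ (x ∷ L) f g =
    trans (cong (f x + g x +_) (∑-distrib-+ L f g)) (+-interchange (f x) (g x) (∑ L f) (∑ L g))

  *-distribˡ-∑ : ∀ (L : List A) c (f : A → Poly) → c * ∑ L f ≡ ∑[ x ← L ] (c * f x)
  *-distribˡ-∑ []      c f = *-zeroʳ c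
  *-distribˡ-∑ (x ∷ L) c f = trans (*-distribˡ-+ c (f x) (∑ L f)) (cong (c * f x +_) (*-distribˡ-∑ L c f))

  ∑-filterᵇ : ∀ (h : A → Poly) (p : A → Bool) L → sumP (map h (filterᵇ p L)) ≡ ∑[ x ← L ] (p x · h x)
  ∑-filterᵇ h p []      = refl
  ∑-filterᵇ h p (x ∷ L) with p x
  ... | true  = cong (h x +_) (∑-filterᵇ h p L)
  ... | false = ∑-filterᵇ h p L

∑-comm : ∀ {A B : Set} (L : List A) (M : List B) (f : A → B → Poly) →
         ∑[ x ← L ] ∑[ y ← M ] f x y ≡ ∑[ y ← M ] ∑[ x ← L ] f x y
∑-comm []      M f = sym (∑-zero M)
∑-comm (x ∷ L) M f =
  trans (cong (∑ M (f x) +_) (∑-comm L M f)) (sym (∑-distrib-+ M (f x) (λ y → ∑[ x ← L ] f x y)))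

sumP-++ : ∀ xs ys → sumP (xs ++ ys) ≡ sumP xs + sumP ys
sumP-++ []       ys = refl
sumP-++ (x ∷ xs) ys = trans (cong (x +_) (sumP-++ xs ys)) (sym (+-assoc x (sumP xs) (sumP ys)))

∑-cartesianProduct : ∀ {A B : Set} (h : A × B → Poly) L M →
                     sumP (map h (cartesianProduct L M)) ≡ ∑[ x ← L ] ∑[ y ← M ] h (x , y)
∑-cartesianProduct h []      M = refl
∑-cartesianProduct h (x ∷ L) M = begin
  sumP (map h (map (x ,_) M ++ cartesianProduct L M))
    ≡⟨ cong sumP (map-++ h (map (x ,_) M) (cartesianProduct L M)) ⟩
  sumP (map h (map (x ,_) M) ++ map h (cartesianProduct L M))
    ≡⟨ sumP-++ (map h (map (x ,_) M)) _ ⟩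
  sumP (map h (map (x ,_) M)) + sumP (map h (cartesianProduct L M))
    ≡⟨ cong₂ _+_ (cong sumP (sym (map-∘ M))) (∑-cartesianProduct h L M) ⟩
  ∑[ y ← M ] h (x , y) + ∑[ x ← L ] ∑[ y ← M ] h (x , y)
    ∎

∑-delta : ∀ {L : List Poly} z (k : Poly → Poly) → Unique L → z ∈ L →
          ∑[ y ← L ] ((y == z) · k y) ≡ k z
∑-delta {z ∷ L} z k (z≢L ∷ _) (here refl) = begin
  (z == z) · k z + ∑[ y ← L ] ((y == z) · k y)
    ≡⟨ cong₂ _+_ (cong (_· k z) (==-true {z} refl)) (∑-cong L others-vanish) ⟩
  k z + ∑[ y ← L ] 0p
    ≡⟨ cong (k z +_) (∑-zero L) ⟩
  k z + 0p
    ≡⟨ +-identityʳ (k z) ⟩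
  k z
    ∎
  where
  others-vanish : ∀ {y} → y ∈ L → (y == z) · k y ≡ 0p
  others-vanish y∈L = cong (_· _) (==-false (λ y≡z → All.lookup z≢L y∈L (sym y≡z)))
∑-delta {x ∷ L} z k (x≢L ∷ uL) (there z∈L) =
  cong₂ _+_ (cong (_· k x) (==-false (All.lookup x≢L z∈L))) (∑-delta z k uL z∈L)

·-·-∧ : ∀ a b {c} p → (a ∧ b) ≡ c → a · (b · p) ≡ c · p
·-·-∧ false b p refl = refl
·-·-∧ true  b p refl = refl

*-· : ∀ c b p → c * (b · p) ≡ b · (c * p)
*-· c false p = *-zeroʳ c
*-· c true  p = refl

·-∑ : ∀ {A : Set} b (L : List A) f → b · ∑ L f ≡ ∑[ x ← L ] (b · f x)
·-∑ false L f = sym (∑-zero L)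
·-∑ true  L f = refl

-- Sums over divisors

-- Sum of f over the divisors of T, for any bound n ≥ deg T.  Keeping n fixed lets the
-- divisors of T and of P * T be summed over the same list.
divisorSum : ℕ → Poly → (Poly → Poly) → Poly
divisorSum n T f = ∑[ D ← nzUpTo n ] (divides? D T · f D)

∑-divisorPairs : ∀ {A} → A ≢ 0p → (h : Poly × Poly → Poly) →
                 sumP (map h (divisorPairs A)) ≡ divisorSum (deg A) A (λ D → h (D , A / D))
∑-divisorPairs {A} A≢0 h = begin
  sumP (map h (divisorPairs A))
    ≡⟨ ∑-filterᵇ h (λ p → (proj₁ p * proj₂ p) == A) (cartesianProduct U U) ⟩
  ∑[ p ← cartesianProduct U U ] (((proj₁ p * proj₂ p) == A) · h p)
    ≡⟨ ∑-cartesianProduct (λ p → ((proj₁ p * proj₂ p) == A) · h p) U U ⟩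
  ∑[ D ← U ] ∑[ E ← U ] (((D * E) == A) · h (D , E))
    ≡⟨ ∑-cong U (λ {D} D∈U → inner-sum D (proj₁ (∈-nzUpTo⁻ _ D∈U))) ⟩
  divisorSum (deg A) A (λ D → h (D , A / D))
    ∎
  where
  U = nzUpTo (deg A)
  inner-sum : ∀ D → D ≢ 0p → ∑[ E ← U ] (((D * E) == A) · h (D , E)) ≡ divides? D A · h (D , A / D)
  inner-sum D D≢0 with divides? D A | divides?-reflects A≢0 D
  ... | true  | ofʸ D∣A = trans (∑-cong U λ {E} _ → cong (_· h (D , E)) (DE==A≡E==A/D E))
                                (∑-delta (A / D) (λ E → h (D , E)) (nzUpTo-unique _) A/D∈U)
    where
    DE==A≡E==A/D : ∀ E → ((D * E) == A) ≡ (E == (A / D))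
    DE==A≡E==A/D E = det (==-reflects (D * E) A)
      (reflects-map (λ E≡A/D → trans (cong (D *_) E≡A/D) (D*[A/D]≡A D≢0 D∣A))
                    (λ DE≡A → sym (/-unique D≢0 DE≡A)) (==-reflects E (A / D)))
    A/D∈U : A / D ∈ U
    A/D∈U = ∣⇒∈nzUpTo {A / D} A≢0 (D , trans (*-comm (A / D) D) (D*[A/D]≡A D≢0 D∣A))
  ... | false | ofⁿ D∤A =
    trans (∑-cong U λ {E} _ → cong (_· h (D , E)) (==-false λ DE≡A → D∤A (E , DE≡A))) (∑-zero U)

module _ (n : ℕ) where

  private
    U = nzUpTo n

  divisorSum-cong : ∀ {T} → T ≢ 0p → ∀ {f g} → (∀ {D} → D ∣ T → f D ≡ g D) →
                    divisorSum n T f ≡ divisorSum n T g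
  divisorSum-cong {T} T≢0 {f} {g} f≗g = ∑-cong U pointwise
    where
    pointwise : ∀ {D} → D ∈ U → divides? D T · f D ≡ divides? D T · g D
    pointwise {D} _ with divides? D T | divides?-reflects T≢0 D
    ... | true  | ofʸ D∣T = f≗g D∣T
    ... | false | ofⁿ _   = refl

  *-distribˡ-divisorSum : ∀ c T f → c * divisorSum n T f ≡ divisorSum n T (λ D → c * f D)
  *-distribˡ-divisorSum c T f =
    trans (*-distribˡ-∑ U c _) (∑-cong U λ {D} _ → *-· c (divides? D T) (f D))

  divisorSum-1 : ∀ f → divisorSum n 1p f ≡ f 1p
  divisorSum-1 f = trans (∑-cong U λ {D} _ → cong (_· f D) (D∣1≡D==1 D))
                         (∑-delta 1p f (nzUpTo-unique n) (∈-nzUpTo⁺ n (λ ()) z≤n))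
    where
    D∣1≡D==1 : ∀ D → divides? D 1p ≡ (D == 1p)
    D∣1≡D==1 D = det (divides?-reflects (λ ()) D)
      (reflects-map (λ { refl → ∣-refl }) ∣1⇒≡1 (==-reflects D 1p))

-- The two alternatives exclude each other because P ∤ T, so xor is just "or".
divides?-*-irreducible : ∀ {P T D} → Irreducible P → T ≢ 0p → ¬ P ∣ T → D ≢ 0p →
  divides? D (P * T) ≡ divides? D T xor (divides? P D ∧ divides? (D / P) T)
divides?-*-irreducible {P} {T} {D} P-irr@(P≢0 , _) T≢0 P∤T D≢0
  with divides?-reflects (*-≢0 P≢0 T≢0) D
     | divides? D T | divides?-reflects T≢0 D | divides? P D | divides?-reflects D≢0 P
... | D∣PT? | true  | ofʸ D∣T | true  | ofʸ P∣D = ⊥-elim (P∤T (∣-trans {P} P∣D D∣T))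
... | D∣PT? | true  | ofʸ D∣T | false | ofⁿ _   = det D∣PT? (ofʸ (∣n⇒∣m*n P {D} D∣T))
... | D∣PT? | false | ofⁿ D∤T | false | ofⁿ P∤D =
  det D∣PT? (ofⁿ λ D∣PT → D∤T (irreducible-∣-cancelˡ P-irr P∤D D∣PT))
... | D∣PT? | false | ofⁿ D∤T | true  | ofʸ P∣D =
  det D∣PT? (reflects-map D/P∣T⇒D∣PT D∣PT⇒D/P∣T (divides?-reflects T≢0 (D / P)))
  where
  P*[D/P]≡D : P * (D / P) ≡ D
  P*[D/P]≡D = D*[A/D]≡A P≢0 P∣D
  D/P∣T⇒D∣PT : (D / P) ∣ T → D ∣ (P * T)
  D/P∣T⇒D∣PT D/P∣T = subst (_∣ (P * T)) P*[D/P]≡D (*-monoʳ-∣ P {D / P} D/P∣T)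
  D∣PT⇒D/P∣T : D ∣ (P * T) → (D / P) ∣ T
  D∣PT⇒D/P∣T (E , DE≡PT) = E , *-cancelˡ P≢0 (begin
    P * (D / P * E)    ≡⟨ sym (*-assoc P (D / P) E) ⟩
    P * (D / P) * E    ≡⟨ cong (_* E) P*[D/P]≡D ⟩
    D * E              ≡⟨ DE≡PT ⟩
    P * T              ∎)

module _ (n : ℕ) where

  private
    U = nzUpTo n

  -- Write F (P * x) as a δ-sum over D, swap the two sums, and collapse the inner one at
  -- x = D / P.
  ∑-reindex-* : ∀ {P T} (F : Poly → Poly) → P ≢ 0p → T ≢ 0p → deg (P * T) ≤ n →
    ∑[ x ← U ] (divides? x T · F (P * x)) ≡ ∑[ D ← U ] ((divides? P D ∧ divides? (D / P) T) · F D)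
  ∑-reindex-* {P} {T} F P≢0 T≢0 PT≤n = begin
    ∑[ x ← U ] (divides? x T · F (P * x))
      ≡⟨ ∑-cong U (λ {x} _ → expand x) ⟩
    ∑[ x ← U ] (divides? x T · ∑[ D ← U ] ((D == (P * x)) · F D))
      ≡⟨ ∑-cong U (λ {x} _ → ·-∑ (divides? x T) U _) ⟩
    ∑[ x ← U ] ∑[ D ← U ] (divides? x T · ((D == (P * x)) · F D))
      ≡⟨ ∑-comm U U _ ⟩
    ∑[ D ← U ] ∑[ x ← U ] (divides? x T · ((D == (P * x)) · F D))
      ≡⟨ ∑-cong U (λ {D} D∈U → collapse D (proj₁ (∈-nzUpTo⁻ n D∈U))) ⟩
    ∑[ D ← U ] ((divides? P D ∧ divides? (D / P) T) · F D)
      ∎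
    where
    PT≢0 = *-≢0 P≢0 T≢0
    T≤n : deg T ≤ n
    T≤n = ℕ.≤-trans (∣⇒deg≤ {T} PT≢0 (n∣m*n P T)) PT≤n
    expand : ∀ x → divides? x T · F (P * x) ≡ divides? x T · ∑[ D ← U ] ((D == (P * x)) · F D)
    expand x with divides? x T | divides?-reflects T≢0 x
    ... | false | _       = refl
    ... | true  | ofʸ x∣T = sym (∑-delta (P * x) F (nzUpTo-unique n)
      (∈-nzUpTo⁺ n (∣-≢0 {P * x} PT≢0 Px∣PT) (ℕ.≤-trans (∣⇒deg≤ {P * x} PT≢0 Px∣PT) PT≤n)))
      where
      Px∣PT = *-monoʳ-∣ P {x} x∣T
    collapse : ∀ D → D ≢ 0p →
      ∑[ x ← U ] (divides? x T · ((D == (P * x)) · F D)) ≡ (divides? P D ∧ divides? (D / P) T) · F D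
    collapse D D≢0
      with divides? P D ∧ divides? (D / P) T
         | divides?-reflects D≢0 P ×-reflects divides?-reflects T≢0 (D / P)
    ... | true  | ofʸ (P∣D , D/P∣T) =
      trans (∑-cong U λ {x} _ → ·-·-∧ (divides? x T) (D == (P * x)) (F D) (x-is-D/P x))
            (∑-delta (D / P) (λ _ → F D) (nzUpTo-unique n) D/P∈U)
      where
      x-is-D/P : ∀ x → (divides? x T ∧ (D == (P * x))) ≡ (x == (D / P))
      x-is-D/P x = det (divides?-reflects T≢0 x ×-reflects ==-reflects D (P * x))
        (reflects-map (λ { refl → D/P∣T , sym (D*[A/D]≡A P≢0 P∣D) })
                      (λ (_ , D≡Px) → sym (/-unique P≢0 (sym D≡Px)))
                      (==-reflects x (D / P)))
      D/P∈U : D / P ∈ U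
      D/P∈U = ∈-nzUpTo⁺ n (∣-≢0 {D / P} T≢0 D/P∣T)
        (ℕ.≤-trans (∣⇒deg≤ {D / P} T≢0 D/P∣T) T≤n)
    ... | false | ofⁿ ¬both =
      trans (∑-cong U λ {x} _ → ·-·-∧ (divides? x T) (D == (P * x)) (F D) (never x)) (∑-zero U)
      where
      never : ∀ x → (divides? x T ∧ (D == (P * x))) ≡ false
      never x = det (divides?-reflects T≢0 x ×-reflects ==-reflects D (P * x))
        (ofⁿ λ (x∣T , D≡Px) →
          ¬both ((x , sym D≡Px) , subst (_∣ T) (sym (/-unique P≢0 (sym D≡Px))) x∣T))

  divisorSum-*-irreducible : ∀ {P T} → Irreducible P → T ≢ 0p → ¬ P ∣ T → deg (P * T) ≤ n → ∀ f →
    divisorSum n (P * T) f ≡ divisorSum n T f + divisorSum n T (λ D → f (P * D))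
  divisorSum-*-irreducible {P} {T} P-irr T≢0 P∤T PT≤n f = begin
    ∑[ D ← U ] (divides? D (P * T) · f D)
      ≡⟨ ∑-cong U (λ {D} D∈U → split D (proj₁ (∈-nzUpTo⁻ n D∈U))) ⟩
    ∑[ D ← U ] (divides? D T · f D + (divides? P D ∧ divides? (D / P) T) · f D)
      ≡⟨ ∑-distrib-+ U _ _ ⟩
    divisorSum n T f + ∑[ D ← U ] ((divides? P D ∧ divides? (D / P) T) · f D)
      ≡⟨ cong (divisorSum n T f +_) (sym (∑-reindex-* f (proj₁ P-irr) T≢0 PT≤n)) ⟩
    divisorSum n T f + divisorSum n T (λ D → f (P * D))
      ∎
    where
    split : ∀ D → D ≢ 0p →
      divides? D (P * T) · f D ≡ divides? D T · f D + (divides? P D ∧ divides? (D / P) T) · f D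
    split D D≢0 = trans (cong (_· f D) (divides?-*-irreducible P-irr T≢0 P∤T D≢0))
                        (·-distrib-xor (divides? D T) (divides? P D ∧ divides? (D / P) T) (f D))

divisorSum-irreducible : ∀ n {P} → Irreducible P → deg P ≤ n → ∀ f → divisorSum n P f ≡ f 1p + f P
divisorSum-irreducible n {P} P-irr P≤n f = begin
  divisorSum n P f
    ≡⟨ cong (λ Q → divisorSum n Q f) (sym (*-identityʳ P)) ⟩
  divisorSum n (P * 1p) f
    ≡⟨ divisorSum-*-irreducible n P-irr (λ ()) P∤1 (subst (_≤ n) (sym (cong deg (*-identityʳ P))) P≤n) f ⟩
  divisorSum n 1p f + divisorSum n 1p (λ D → f (P * D))
    ≡⟨ cong₂ _+_ (divisorSum-1 n f) (divisorSum-1 n (λ D → f (P * D))) ⟩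
  f 1p + f (P * 1p)
    ≡⟨ cong (λ Q → f 1p + f Q) (*-identityʳ P) ⟩
  f 1p + f P
    ∎
  where
  P∤1 : ¬ P ∣ 1p
  P∤1 P∣1 = proj₁ (proj₂ P-irr) (∣1⇒≡1 {P} P∣1)

⋆-divisorSum : ∀ f g {A} → A ≢ 0p → (f ⋆ g) A ≡ divisorSum (deg A) A (λ D → f D * g (A / D))
⋆-divisorSum f g A≢0 = ∑-divisorPairs A≢0 (λ p → f (proj₁ p) * g (proj₂ p))

-- Square-free polynomials

irreducible-or-proper-divisor : ∀ {T} → T ≢ 0p → T ≢ 1p →
  Irreducible T ⊎ ∃ λ D → D ∣ T × D ≢ 1p × D ≢ T
irreducible-or-proper-divisor {T} T≢0 T≢1
  with any proper? (nzUpTo (deg T))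
     | any-reflects proper? (nzUpTo (deg T)) (λ {D} _ →
         divides?-reflects T≢0 D ×-reflects ¬-reflects (==-reflects D 1p) ×-reflects ¬-reflects (==-reflects D T))
  where
  proper? : Poly → Bool
  proper? D = divides? D T ∧ not (D == 1p) ∧ not (D == T)
... | true  | ofʸ (D , _ , D∣T , D≢1 , D≢T) = inj₂ (D , D∣T , D≢1 , D≢T)
... | false | ofⁿ none = inj₁ (T≢0 , T≢1 , trivial)
  where
  trivial : ∀ D → D ∣ T → D ≡ 1p ⊎ D ≡ T
  trivial D D∣T with D ≟ 1p | D ≟ T
  ... | yes D≡1 | _       = inj₁ D≡1
  ... | no _    | yes D≡T = inj₂ D≡T
  ... | no D≢1  | no D≢T  = ⊥-elim (none (D , ∣⇒∈nzUpTo {D} T≢0 D∣T , D∣T , D≢1 , D≢T))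

irreducible-factor-< : ∀ n {T} → deg T < n → T ≢ 0p → T ≢ 1p → ∃ λ P → Irreducible P × P ∣ T
irreducible-factor-< (suc n) {T} T<n T≢0 T≢1 with irreducible-or-proper-divisor T≢0 T≢1
... | inj₁ T-irr = T , T-irr , ∣-refl
... | inj₂ (D , D∣T , D≢1 , D≢T)
  with irreducible-factor-< n (ℕ.<-≤-trans (∣∧≢⇒deg< {D} T≢0 D∣T D≢T) (ℕ.≤-pred T<n))
                              (∣-≢0 {D} T≢0 D∣T) D≢1
...   | P , P-irr , P∣D = P , P-irr , ∣-trans {P} P∣D D∣T

irreducible-factor : ∀ {T} → T ≢ 0p → T ≢ 1p → ∃ λ P → Irreducible P × P ∣ T
irreducible-factor = irreducible-factor-< _ (ℕ.n<1+n _)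

squarefree-∣ : ∀ {D T} → SquareFree T → D ∣ T → SquareFree D
squarefree-∣ {D} (T≢0 , no-square) D∣T =
  ∣-≢0 {D} T≢0 D∣T , λ P P-irr PP∣D → no-square P P-irr (∣-trans {P * P} PP∣D D∣T)

squarefree-split : ∀ {T} → SquareFree T → T ≢ 1p →
  ∃₂ λ P T′ → Irreducible P × T ≡ P * T′ × SquareFree T′ × ¬ P ∣ T′
squarefree-split {T} T-sqf@(T≢0 , no-square) T≢1 with irreducible-factor T≢0 T≢1
... | P , P-irr , P∣T =
  P , T / P , P-irr , sym P*[T/P]≡T , squarefree-∣ T-sqf (P , trans (*-comm (T / P) P) P*[T/P]≡T) , P∤T/P
  where
  P*[T/P]≡T = D*[A/D]≡A (proj₁ P-irr) P∣T
  P∤T/P : ¬ P ∣ (T / P)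
  P∤T/P (E , PE≡T/P) = no-square P P-irr (E , trans (*-assoc P P E) (trans (cong (P *_) PE≡T/P) P*[T/P]≡T))

module _ {ℓ : Level} (Φ : Poly → Set ℓ) (Φ-1 : Φ 1p)
         (Φ-* : ∀ {P T} → Irreducible P → SquareFree T → ¬ P ∣ T → Φ T → Φ (P * T)) where

  squarefree-ind-< : ∀ n {T} → deg T < n → SquareFree T → Φ T
  squarefree-ind-< (suc n) {T} T<n T-sqf with T ≟ 1p
  ... | yes refl = Φ-1
  ... | no T≢1 with squarefree-split T-sqf T≢1
  ...   | P , T′ , P-irr , refl , T′-sqf , P∤T′ =
    Φ-* P-irr T′-sqf P∤T′ (squarefree-ind-< n (ℕ.<-≤-trans T′<PT′ (ℕ.≤-pred T<n)) T′-sqf)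
    where
    T′<PT′ : deg T′ < deg (P * T′)
    T′<PT′ = subst (deg T′ <_) (sym (deg-* (proj₁ P-irr) (proj₁ T′-sqf)))
                   (ℕ.+-monoˡ-≤ (deg T′) (≢0∧≢1⇒deg≥1 (proj₁ P-irr) (proj₁ (proj₂ P-irr))))

  squarefree-ind : ∀ {T} → SquareFree T → Φ T
  squarefree-ind = squarefree-ind-< _ (ℕ.n<1+n _)

squarefree-∣-square : ∀ {D S} → SquareFree D → D ∣ (S * S) → D ∣ S
squarefree-∣-square D-sqf =
  squarefree-ind (λ D → ∀ {S} → D ∣ (S * S) → D ∣ S) (λ {S} _ → 1∣ S) step D-sqf
  where
  step : ∀ {P D} → Irreducible P → SquareFree D → ¬ P ∣ D →
         (∀ {S} → D ∣ (S * S) → D ∣ S) → ∀ {S} → (P * D) ∣ (S * S) → (P * D) ∣ S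
  step {P} {D} P-irr@(P≢0 , _) _ P∤D ih {S} (k , PDk≡SS) =
    subst ((P * D) ∣_) P*S₁≡S (*-monoʳ-∣ P {D} (ih D∣S₁S₁))
    where
    P∣S : P ∣ S
    P∣S = reduce (euclid P-irr (D * k , trans (sym (*-assoc P D k)) PDk≡SS))
    S₁ = S / P
    P*S₁≡S : P * S₁ ≡ S
    P*S₁≡S = D*[A/D]≡A P≢0 P∣S
    regroup : ∀ P S₁ → (P * S₁) * (P * S₁) ≡ P * (P * (S₁ * S₁))
    regroup = solve-∀ F₂[x]-solver
    D∣S₁S₁ : D ∣ (S₁ * S₁)
    D∣S₁S₁ = irreducible-∣-cancelˡ P-irr P∤D (k , *-cancelˡ P≢0 (begin
      P * (D * k)          ≡⟨ sym (*-assoc P D k) ⟩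
      P * D * k            ≡⟨ PDk≡SS ⟩
      S * S                ≡⟨ cong₂ _*_ (sym P*S₁≡S) (sym P*S₁≡S) ⟩
      (P * S₁) * (P * S₁)  ≡⟨ regroup P S₁ ⟩
      P * (P * (S₁ * S₁))  ∎))

square∤ : ∀ {S} → S ≢ 0p → S ≢ 1p → ¬ (S * S) ∣ S
square∤ {S} S≢0 S≢1 SS∣S = ℕ.<-irrefl refl (ℕ.<-≤-trans (ℕ.m<m+n (deg S) (≢0∧≢1⇒deg≥1 S≢0 S≢1))
  (subst (_≤ deg S) (deg-* S≢0 S≢0) (∣⇒deg≤ {S * S} S≢0 SS∣S)))

-- The radical of a square

∏ : List Poly → Poly
∏ = foldr _*_ 1p

filterᵇ-cong : ∀ {A : Set} {p q : A → Bool} L → (∀ {x} → x ∈ L → p x ≡ q x) →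
               filterᵇ p L ≡ filterᵇ q L
filterᵇ-cong         []      _   = refl
filterᵇ-cong {p = p} {q} (x ∷ L) p≗q with p x | q x | p≗q (here refl)
... | true  | true  | _ = cong (x ∷_) (filterᵇ-cong L (p≗q ∘ there))
... | false | false | _ = filterᵇ-cong L (p≗q ∘ there)
... | true  | false | ()
... | false | true  | ()

filterᵇ-none : ∀ {A : Set} {p : A → Bool} L → (∀ {x} → x ∈ L → p x ≡ false) → filterᵇ p L ≡ []
filterᵇ-none         []      _ = refl
filterᵇ-none {p = p} (x ∷ L) none with p x | none (here refl)
... | false | _ = filterᵇ-none L (none ∘ there)
... | true  | ()

∏-filterᵇ-insert : ∀ {L} (a : Poly → Bool) P → Unique L → P ∈ L → a P ≡ false →
                   ∏ (filterᵇ (λ y → a y ∨ (y == P)) L) ≡ P * ∏ (filterᵇ a L)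
∏-filterᵇ-insert {P ∷ L} a P (P∉L ∷ _) (here refl) aP≡false
  rewrite aP≡false | ==-true {P} refl =
    cong (λ L′ → P * ∏ L′) (filterᵇ-cong L λ y∈L →
      trans (cong (a _ ∨_) (==-false λ y≡P → All.lookup P∉L y∈L (sym y≡P))) (∨-identityʳ _))
∏-filterᵇ-insert {x ∷ L} a P (x∉L ∷ uL) (there P∈L) aP≡false
  rewrite ==-false (All.lookup x∉L P∈L) | ∨-identityʳ (a x) with a x
... | false = ∏-filterᵇ-insert a P uL P∈L aP≡false
... | true  = trans (cong (x *_) (∏-filterᵇ-insert a P uL P∈L aP≡false)) (*-swap x P _)

∏-irreducible-divisors : ∀ n {T} → SquareFree T → deg T ≤ n →
                         ∏ (filterᵇ (λ y → irreducible? y ∧ divides? y T) (nzUpTo n)) ≡ T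
∏-irreducible-divisors n = squarefree-ind Φ base step
  where
  Φ : Poly → Set
  Φ T = deg T ≤ n → ∏ (filterᵇ (λ y → irreducible? y ∧ divides? y T) (nzUpTo n)) ≡ T
  base : Φ 1p
  base _ = cong ∏ (filterᵇ-none (nzUpTo n) λ {y} _ →
    det (irreducible?-reflects y ×-reflects divides?-reflects (λ ()) y)
        (ofⁿ λ (y-irr , y∣1) → proj₁ (proj₂ y-irr) (∣1⇒≡1 y∣1)))
  step : ∀ {P T} → Irreducible P → SquareFree T → ¬ P ∣ T → Φ T → Φ (P * T)
  step {P} {T} P-irr@(P≢0 , _) (T≢0 , _) P∤T ih PT≤n = begin
    ∏ (filterᵇ (λ y → irreducible? y ∧ divides? y (P * T)) U)
      ≡⟨ cong ∏ (filterᵇ-cong U λ {y} _ → new-factor y) ⟩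
    ∏ (filterᵇ (λ y → (irreducible? y ∧ divides? y T) ∨ (y == P)) U)
      ≡⟨ ∏-filterᵇ-insert (λ y → irreducible? y ∧ divides? y T) P (nzUpTo-unique n) P∈U
           (det (irreducible?-reflects P ×-reflects divides?-reflects T≢0 P) (ofⁿ (P∤T ∘ proj₂))) ⟩
    P * ∏ (filterᵇ (λ y → irreducible? y ∧ divides? y T) U)
      ≡⟨ cong (P *_) (ih (ℕ.≤-trans (∣⇒deg≤ {T} PT≢0 (n∣m*n P T)) PT≤n)) ⟩
    P * T
      ∎
    where
    U = nzUpTo n
    PT≢0 = *-≢0 P≢0 T≢0
    P∈U : P ∈ U
    P∈U = ∈-nzUpTo⁺ n P≢0 (ℕ.≤-trans (∣⇒deg≤ {P} PT≢0 (m∣m*n P T)) PT≤n)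
    new-factor : ∀ y → (irreducible? y ∧ divides? y (P * T)) ≡ ((irreducible? y ∧ divides? y T) ∨ (y == P))
    new-factor y = det (irreducible?-reflects y ×-reflects divides?-reflects PT≢0 y)
      (reflects-map (λ { (inj₁ (y-irr , y∣T)) → y-irr , ∣n⇒∣m*n P {y} y∣T
                       ; (inj₂ refl)          → P-irr , m∣m*n P T })
                    (λ (y-irr , y∣PT) → case-euclid y-irr (euclid y-irr y∣PT))
                    ((irreducible?-reflects y ×-reflects divides?-reflects T≢0 y) ⊎-reflects ==-reflects y P))
      where
      case-euclid : Irreducible y → y ∣ P ⊎ y ∣ T → (Irreducible y × y ∣ T) ⊎ y ≡ P
      case-euclid y-irr (inj₁ y∣P) = inj₂ (irreducible-∣-irreducible y-irr P-irr y∣P)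
      case-euclid y-irr (inj₂ y∣T) = inj₁ (y-irr , y∣T)

rad-square : ∀ {S} → SquareFree S → rad (S * S) ≡ S
rad-square {S} S-sqf@(S≢0 , _) = begin
  rad (S * S)
    ≡⟨ cong ∏ (filterᵇ-cong (nzUpTo (deg (S * S))) λ {y} _ → same-irreducible-divisors y) ⟩
  ∏ (filterᵇ (λ y → irreducible? y ∧ divides? y S) (nzUpTo (deg (S * S))))
    ≡⟨ ∏-irreducible-divisors (deg (S * S)) S-sqf (∣⇒deg≤ {S} SS≢0 (m∣m*n S S)) ⟩
  S ∎
  where
  SS≢0 = *-≢0 S≢0 S≢0
  same-irreducible-divisors : ∀ y → (irreducible? y ∧ divides? y (S * S)) ≡ (irreducible? y ∧ divides? y S)
  same-irreducible-divisors y = det (irreducible?-reflects y ×-reflects divides?-reflects SS≢0 y)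
    (reflects-map (λ (y-irr , y∣S) → y-irr , ∣n⇒∣m*n S {y} y∣S)
                  (λ (y-irr , y∣SS) → y-irr , reduce (euclid y-irr y∣SS))
                  (irreducible?-reflects y ×-reflects divides?-reflects S≢0 y))

-- The inverse of σ*

σ*-irreducible : ∀ {P} → Irreducible P → σ* P ≡ 1p + P
σ*-irreducible {P} P-irr@(P≢0 , _) = begin
  σ* P
    ≡⟨ ∑-filterᵇ proj₁ (λ p → coprime? (proj₁ p) (proj₂ p)) (divisorPairs P) ⟩
  sumP (map (λ p → coprime? (proj₁ p) (proj₂ p) · proj₁ p) (divisorPairs P))
    ≡⟨ ∑-divisorPairs P≢0 (λ p → coprime? (proj₁ p) (proj₂ p) · proj₁ p) ⟩
  divisorSum (deg P) P (λ D → coprime? D (P / D) · D)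
    ≡⟨ divisorSum-irreducible (deg P) P-irr ℕ.≤-refl _ ⟩
  coprime? 1p (P / 1p) · 1p + coprime? P (P / P) · P
    ≡⟨ cong₂ (λ Q R → coprime? 1p Q · 1p + coprime? P R · P) (A/1≡A P) (A/A≡1 P≢0) ⟩
  coprime? 1p P · 1p + coprime? P 1p · P
    ≡⟨ cong₂ (λ a b → a · 1p + b · P) (det (coprime?-reflects (λ ()) P≢0) (ofʸ λ _ C∣1 _ → ∣1⇒≡1 C∣1))
                                       (det (coprime?-reflects P≢0 (λ ())) (ofʸ λ _ _ C∣1 → ∣1⇒≡1 C∣1)) ⟩
  1p + P
    ∎

module σ*-Inverse (g : Poly → Poly) (g-mult : Multiplicative g)
                  (σ*⋆g≡δ : ∀ A → ¬ (A ≡ 0p) → (σ* ⋆ g) A ≡ δ A) where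

  g-1 : g 1p ≡ 1p
  g-1 = trans (sym (+-identityʳ (g 1p))) (σ*⋆g≡δ 1p (λ ()))

  g-irreducible : ∀ {P} → Irreducible P → g P ≡ 1p + P
  g-irreducible {P} P-irr@(P≢0 , P≢1 , _) = x+y≡0⇒x≡y (sym (begin
    0p                                     ≡⟨ cong (_· 1p) (sym (==-false P≢1)) ⟩
    δ P                                    ≡⟨ sym (σ*⋆g≡δ P P≢0) ⟩
    (σ* ⋆ g) P                             ≡⟨ ⋆-divisorSum σ* g P≢0 ⟩
    divisorSum (deg P) P (λ D → σ* D * g (P / D))
                                           ≡⟨ divisorSum-irreducible (deg P) P-irr ℕ.≤-refl _ ⟩
    σ* 1p * g (P / 1p) + σ* P * g (P / P)
                                           ≡⟨ cong₂ (λ Q R → σ* 1p * g Q + σ* P * g R) (A/1≡A P) (A/A≡1 P≢0) ⟩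
    g P + σ* P * g 1p                      ≡⟨ cong₂ (λ s t → g P + s * t) (σ*-irreducible P-irr) g-1 ⟩
    g P + (1p + P) * 1p                    ≡⟨ cong (g P +_) (*-identityʳ (1p + P)) ⟩
    g P + (1p + P)                         ∎))

  g-*-irreducible : ∀ {P X} → Irreducible P → ¬ P ∣ X → X ≢ 0p → g (P * X) ≡ (1p + P) * g X
  g-*-irreducible {P} {X} P-irr P∤X X≢0 =
    trans (g-mult P X (proj₁ P-irr) X≢0 (irreducible-coprime P-irr P∤X)) (cong (_* g X) (g-irreducible P-irr))

  ∑-g-quotient : ∀ n {T} → SquareFree T → deg T ≤ n → divisorSum n T (λ D → g D * (T / D)) ≡ 1p
  ∑-g-quotient n = squarefree-ind (λ T → deg T ≤ n → divisorSum n T (λ D → g D * (T / D)) ≡ 1p) base step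
    where
    base : deg 1p ≤ n → divisorSum n 1p (λ D → g D * (1p / D)) ≡ 1p
    base _ = trans (divisorSum-1 n _) (cong₂ _*_ g-1 (A/1≡A 1p))
    step : ∀ {P T} → Irreducible P → SquareFree T → ¬ P ∣ T →
           (deg T ≤ n → divisorSum n T (λ D → g D * (T / D)) ≡ 1p) →
           deg (P * T) ≤ n → divisorSum n (P * T) (λ D → g D * (P * T / D)) ≡ 1p
    step {P} {T} P-irr@(P≢0 , _) (T≢0 , _) P∤T ih PT≤n = begin
      divisorSum n (P * T) (λ D → g D * (P * T / D))
        ≡⟨ divisorSum-*-irreducible n P-irr T≢0 P∤T PT≤n _ ⟩
      divisorSum n T (λ D → g D * (P * T / D)) + divisorSum n T (λ D → g (P * D) * (P * T / (P * D)))
        ≡⟨ cong₂ _+_ (divisorSum-cong n T≢0 divisor-term) (divisorSum-cong n T≢0 multiple-term) ⟩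
      divisorSum n T (λ D → P * G D) + divisorSum n T (λ D → (1p + P) * G D)
        ≡⟨ sym (cong₂ _+_ (*-distribˡ-divisorSum n P T G) (*-distribˡ-divisorSum n (1p + P) T G)) ⟩
      P * divisorSum n T G + (1p + P) * divisorSum n T G
        ≡⟨ cong (λ s → P * s + (1p + P) * s) (ih T≤n) ⟩
      P * 1p + (1p + P) * 1p
        ≡⟨ char-2 P ⟩
      1p
        ∎
      where
      T≤n : deg T ≤ n
      T≤n = ℕ.≤-trans (∣⇒deg≤ {T} (*-≢0 P≢0 T≢0) (n∣m*n P T)) PT≤n
      G : Poly → Poly
      G D = g D * (T / D)
      char-2 : ∀ P → P * 1p + (1p + P) * 1p ≡ 1p
      char-2 = solve-∀ F₂[x]-solver
      divisor-term : ∀ {D} → D ∣ T → g D * (P * T / D) ≡ P * G D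
      divisor-term {D} D∣T = a*[C*T/D]≡C*[a*[T/D]] (g D) P (∣-≢0 {D} T≢0 D∣T) D∣T
      multiple-term : ∀ {D} → D ∣ T → g (P * D) * (P * T / (P * D)) ≡ (1p + P) * G D
      multiple-term {D} D∣T = begin
        g (P * D) * (P * T / (P * D))  ≡⟨ cong₂ _*_ (g-*-irreducible P-irr (λ P∣D → P∤T (∣-trans {P} P∣D D∣T)) D≢0)
                                                    ([C*T]/[C*D]≡T/D P≢0 D≢0 D∣T) ⟩
        (1p + P) * g D * (T / D)       ≡⟨ *-assoc (1p + P) (g D) (T / D) ⟩
        (1p + P) * G D                 ∎
        where
        D≢0 = ∣-≢0 {D} T≢0 D∣T

  corSum-square : ∀ {S} → SquareFree S → S ≢ 1p → corSum g (S * S) ≡ S + S * S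
  corSum-square {S} S-sqf@(S≢0 , _) S≢1 = begin
    corSum g A
      ≡⟨ ∑-filterᵇ (λ p → g (proj₁ p) * proj₂ p) (λ p → proper? (proj₁ p)) (divisorPairs A) ⟩
    sumP (map (λ p → proper? (proj₁ p) · (g (proj₁ p) * proj₂ p)) (divisorPairs A))
      ≡⟨ ∑-divisorPairs A≢0 (λ p → proper? (proj₁ p) · (g (proj₁ p) * proj₂ p)) ⟩
    divisorSum N A (λ D → proper? D · h D)
      ≡⟨ ∑-cong U (λ {D} _ → ·-·-∧ (divides? D A) (proper? D) (h D) (proper-divisor D)) ⟩
    ∑[ D ← U ] ((divides? D S ∧ not (D == 1p)) · h D)
      ≡⟨ ∑-cong U (λ {D} _ → split-off-1 D) ⟩
    ∑[ D ← U ] (divides? D S · h D + (D == 1p) · h D)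
      ≡⟨ ∑-distrib-+ U _ _ ⟩
    divisorSum N S h + ∑[ D ← U ] ((D == 1p) · h D)
      ≡⟨ cong₂ _+_ (divisorSum-cong N S≢0 h≡S*G) (∑-delta 1p h (nzUpTo-unique N) 1∈U) ⟩
    divisorSum N S (λ D → S * G D) + h 1p
      ≡⟨ cong₂ _+_ (sym (*-distribˡ-divisorSum N S S G)) (cong₂ _*_ g-1 (A/1≡A A)) ⟩
    S * divisorSum N S G + A
      ≡⟨ cong (λ s → S * s + A) (∑-g-quotient N S-sqf (∣⇒deg≤ {S} A≢0 (m∣m*n S S))) ⟩
    S * 1p + A
      ≡⟨ cong (_+ A) (*-identityʳ S) ⟩
    S + A
      ∎
    where
    A = S * S
    N = deg A
    U = nzUpTo N
    A≢0 = *-≢0 S≢0 S≢0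
    1∈U : 1p ∈ U
    1∈U = ∈-nzUpTo⁺ N (λ ()) z≤n
    proper? : Poly → Bool
    proper? D = not (D == A) ∧ not (D == 1p) ∧ squarefree? D
    h G : Poly → Poly
    h D = g D * (A / D)
    G D = g D * (S / D)
    h≡S*G : ∀ {D} → D ∣ S → h D ≡ S * G D
    h≡S*G {D} D∣S = a*[C*T/D]≡C*[a*[T/D]] (g D) S (∣-≢0 {D} S≢0 D∣S) D∣S
    proper-divisor : ∀ D → (divides? D A ∧ proper? D) ≡ (divides? D S ∧ not (D == 1p))
    proper-divisor D = det
      (divides?-reflects A≢0 D ×-reflects ¬-reflects (==-reflects D A)
         ×-reflects ¬-reflects (==-reflects D 1p) ×-reflects squarefree?-reflects D)
      (reflects-map (λ (D∣S , D≢1) →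
                       ∣n⇒∣m*n S {D} D∣S , (λ { refl → square∤ S≢0 S≢1 D∣S }) , D≢1 , squarefree-∣ S-sqf D∣S)
                    (λ (D∣A , _ , D≢1 , D-sqf) → squarefree-∣-square D-sqf D∣A , D≢1)
                    (divides?-reflects S≢0 D ×-reflects ¬-reflects (==-reflects D 1p)))
    split-off-1 : ∀ D → (divides? D S ∧ not (D == 1p)) · h D ≡ divides? D S · h D + (D == 1p) · h D
    split-off-1 D with D ≟ 1p
    ... | yes refl rewrite det (divides?-reflects S≢0 1p) (ofʸ (1∣ S)) = sym (x+x≡0 (h 1p))
    ... | no D≢1 rewrite ==-false D≢1 | ∧-identityʳ (divides? D S) = sym (+-identityʳ _)

corollary4p22 : (g : Poly → Poly) → Multiplicative g →
    (∀ A → ¬ (A ≡ 0p) → (σ* ⋆ g) A ≡ δ A) →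
    ∀ A → Special A → Perfect A → A ≡ rad A + corSum g A
corollary4p22 g g-mult σ*⋆g≡δ .(S * S) (S , S-sqf , refl) _ with S ≟ 1p
... | yes refl = refl
... | no S≢1 = begin
  S * S                           ≡⟨ char-2 S (S * S) ⟩
  S + (S + S * S)                 ≡⟨ cong₂ _+_ (sym (rad-square S-sqf)) (sym (corSum-square S-sqf S≢1)) ⟩
  rad (S * S) + corSum g (S * S)  ∎
  where
  open σ*-Inverse g g-mult σ*⋆g≡δ using (corSum-square)
  char-2 : ∀ S A → A ≡ S + (S + A)
  char-2 = solve-∀ F₂[x]-solver
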